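{- Let $m$ be an odd positive integer and $D_{2m}=\langle a,b\mid a^{2m}=b^2=1,\ bab=a^{ -1}\rangle$ the dihedral group of order $4m$. Let $S_1=\{a^m\}$, $S_2=b\langle a^2\rangle$ and $S=S_1\cup S_2$. Then the Cayley graph $X(D_{2m},S)$ is connected and integral.
   Context: The Cayley graph $X(G,S)$ (for $S\subseteq G\setminus\{1\}$, $S=S^{ -1}$) has vertex set $G$, $x,y$ adjacent iff $x^{ -1}y\in S$. A graph is integral if all eigenvalues of its adjacency matrix are integers. -}

module Defs where

open import Data.Nat as ℕ using (ℕ; zero; suc; NonZero)
open import Data.Nat.Properties using (m*n≢0)
open import Data.Nat.DivMod using (_mod_)
open import Data.Fin as Fin using (Fin; zero; suc; toℕ; punchIn; remQuot; combine)
open import Data.Fin.Properties using (_≟_)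
open import Data.Integer as ℤ using (ℤ; +_; _-_; _*_; -_)
open import Data.List as List using (List; []; _∷_; map; allFin)
open import Data.List.Membership.Propositional using (_∈_)
open import Data.Product using (_×_; _,_; Σ)
open import Data.Bool using (if_then_else_)
open import Relation.Nullary.Decidable using (⌊_⌋)
open import Relation.Binary.PropositionalEquality using (_≡_)

record FinGroupOps (N : ℕ) : Set where
  field
    _·_ : Fin N → Fin N → Fin N
    e   : Fin N
    inv : Fin N → Fin N

module _ {N : ℕ} (G : FinGroupOps N) (S : List (Fin N)) where
  open FinGroupOps G

  Adjacent : Fin N → Fin N → Set
  Adjacent x y = (inv x · y) ∈ S

  data Walk : Fin N → Fin N → Set where
    here : ∀ {x} → Walk x x
    step : ∀ {x y z} → Adjacent x y → Walk y z → Walk x z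

  Connected : Set
  Connected = ∀ x y → Walk x y

  -- number of s ∈ S with x⁻¹ y = s (equals 1 if x~y, 0 otherwise,
  -- when S is listed without repetitions)
  count : Fin N → List (Fin N) → ℤ
  count g []       = + 0
  count g (s ∷ ss) = (if ⌊ g ≟ s ⌋ then + 1 else + 0) ℤ.+ count g ss

  adjMatrix : Fin N → Fin N → ℤ
  adjMatrix x y = count (inv x · y) S

sumℤ : List ℤ → ℤ
sumℤ []       = + 0
sumℤ (x ∷ xs) = x ℤ.+ sumℤ xs

prodFin : ∀ n → (Fin n → ℤ) → ℤ
prodFin zero    f = + 1
prodFin (suc n) f = f zero * prodFin n (λ i → f (suc i))

sign : ℕ → ℤ
sign zero          = + 1
sign (suc zero)    = - (+ 1)
sign (suc (suc k)) = sign k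

det : ∀ n → (Fin n → Fin n → ℤ) → ℤ
det zero    A = + 1
det (suc n) A =
  sumℤ (map (λ j → sign (toℕ j) * A zero j * det n (λ r c → A (suc r) (punchIn j c)))
            (allFin (suc n)))

charPolyAt : ∀ n → (Fin n → Fin n → ℤ) → ℤ → ℤ
charPolyAt n A x = det n (λ i j → (if ⌊ i ≟ j ⌋ then x else + 0) - A i j)

-- A graph (given by its adjacency matrix) is integral iff all eigenvalues
-- are integers, i.e. the characteristic polynomial splits as
-- ∏ (x - λᵢ) with λᵢ ∈ ℤ.  Polynomial identity over ℤ is expressed as
-- equality of the polynomial functions on ℤ (ℤ is infinite).
Integral : ∀ n → (Fin n → Fin n → ℤ) → Set
Integral n A = Σ (Fin n → ℤ) λ λs → ∀ (x : ℤ) → charPolyAt n A x ≡ prodFin n (λ i → x - λs i)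

-- Element (ε , i) ∈ Fin 2 × Fin (2m) stands for a^i b^ε; the carrier is
-- Fin (2 * (2m)) via the bijection remQuot / combine.

module Dihedral (m : ℕ) .{{_ : NonZero m}} where
  n : ℕ
  n = 2 ℕ.* m

  instance
    nz : NonZero n
    nz = m*n≢0 2 m

  Elem : Set
  Elem = Fin 2 × Fin n

  -- a^i b^ε · a^k b^δ = a^(i + (-1)^ε k) b^(ε+δ)
  mulE : Elem → Elem → Elem
  mulE (zero , i)     (zero , k)     = zero , ((toℕ i ℕ.+ toℕ k) mod n)
  mulE (zero , i)     (suc zero , k) = suc zero , ((toℕ i ℕ.+ toℕ k) mod n)
  mulE (suc zero , i) (zero , k)     = suc zero , ((toℕ i ℕ.+ (n ℕ.∸ toℕ k)) mod n)
  mulE (suc zero , i) (suc zero , k) = zero , ((toℕ i ℕ.+ (n ℕ.∸ toℕ k)) mod n)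

  invE : Elem → Elem
  invE (zero , i)     = zero , ((n ℕ.∸ toℕ i) mod n)
  invE (suc zero , i) = suc zero , i

  enc : Elem → Fin (2 ℕ.* n)
  enc (ε , i) = combine ε i

  dec : Fin (2 ℕ.* n) → Elem
  dec = remQuot n

  D : FinGroupOps (2 ℕ.* n)
  D = record
    { _·_ = λ x y → enc (mulE (dec x) (dec y))
    ; e   = enc (zero , (0 mod n))
    ; inv = λ x → enc (invE (dec x))
    }

  open FinGroupOps D

  a^ : ℕ → Fin (2 ℕ.* n)
  a^ k = enc (zero , (k mod n))

  b : Fin (2 ℕ.* n)
  b = enc (suc zero , (0 mod n))

  S₁ : List (Fin (2 ℕ.* n))
  S₁ = a^ m ∷ []

  -- S₂ = b⟨a²⟩ = { b a^(2j) : 0 ≤ j < m }   (⟨a²⟩ has order m)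
  S₂ : List (Fin (2 ℕ.* n))
  S₂ = map (λ j → b · a^ (2 ℕ.* toℕ j)) (allFin m)

  S : List (Fin (2 ℕ.* n))
  S = S₁ List.++ S₂

{-# OPTIONS --safe #-}
module Submission where

-- Write the vertex a^i b^ε as (ε , i). The a^m-edges join (ε , i) and (ε , i + m), and the edges
-- from b⟨a²⟩ join (0 , i) and (1 , j) exactly when i ≡ j (mod 2). So xI − A has the block form
-- [[P, Q], [Q, P]] and det (xI − A) = det (P + Q) · det (P − Q). As m is odd, i + m and i have
-- opposite parities, so writing i = m h + a (h < 2, a < m) puts each P ± Q into the same symmetric
-- block form once more, with blocks y I + c u uᵀ where u is constant or u a = (−1)^a. Such a
-- block has determinant y^(m−1) (y + c m); hence the eigenvalues are ±1 ± m, once each, and ±1,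
-- 2(m − 1) times each. For connectivity, the b⟨a²⟩-edges join vertices of equal parity in the two
-- cosets of ⟨a⟩, and an a^m-edge changes the parity.

open import Defs
open import Data.Bool using (if_then_else_)
open import Data.Empty using (⊥-elim)
open import Data.Fin as Fin using (Fin; zero; suc; toℕ; punchIn; inject₁; _↑ˡ_; _↑ʳ_; splitAt; combine; remQuot)
open import Data.Fin.Properties as FinP using (_≟_)
open import Data.Integer using (ℤ; +_; 0ℤ; 1ℤ; -1ℤ)
import Data.Integer.Properties as ℤP
open import Algebra.Properties.Semiring.Sum ℤP.+-*-semiring
  using (sum; ∑-distrib-+; ∑-comm; *-distribˡ-sum; sum-cong-≋)
open import Data.Integer.Tactic.RingSolver using (solve-∀)
import Data.Nat.Tactic.RingSolver as ℕ-Solver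
open import Data.List as List using (tabulate)
open import Data.List.Membership.Propositional using (_∈_)
open import Data.List.Properties using (map-tabulate)
open import Data.List.Relation.Unary.Any using (here; there)
open import Data.Nat as ℕ using (ℕ; zero; suc; NonZero; parity)
open import Data.Nat.DivMod using (_%_; _mod_; _/_; m%n<n; m<n⇒m%n≡m; [m+n]%n≡m%n; %-distribˡ-+; m%n%n≡m%n; m≡m%n+[m/n]*n)
import Data.Nat.Properties as ℕP
open import Data.Parity.Base as ℙ using (Parity; 0ℙ; 1ℙ)
import Data.Parity.Properties as ℙP
open import Data.Product using (Σ; ∃; _,_; _×_; proj₁; proj₂; uncurry)
open import Data.Sum using (inj₁; inj₂; [_,_]′)
open import Function using (_∘_; id; _⇔_; mk⇔; Equivalence)
open import Relation.Binary using (tri<; tri≈; tri>)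
open import Relation.Binary.PropositionalEquality
open import Relation.Nullary using (yes; no; ¬_; does)
open import Relation.Nullary.Decidable using (⌊_⌋)

module Determinant where

  open import Data.Integer using (_+_; _-_; _*_; -_; _^_)

  private variable n : ℕ

  ∑-zero : {f : Fin n → ℤ} → (∀ i → f i ≡ 0ℤ) → sum f ≡ 0ℤ
  ∑-zero {zero}  _ = refl
  ∑-zero {suc n} h = cong₂ _+_ (h zero) (∑-zero (h ∘ suc))

  ∑-single : (f : Fin n → ℤ) (k : Fin n) → (∀ i → i ≢ k → f i ≡ 0ℤ) → sum f ≡ f k
  ∑-single f zero    h = trans (cong (_+_ (f zero)) (∑-zero λ i → h (suc i) λ ())) (ℤP.+-identityʳ (f zero))
  ∑-single f (suc k) h =
    trans (cong (_+ sum (f ∘ suc)) (h zero λ ()))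
          (trans (ℤP.+-identityˡ _) (∑-single (f ∘ suc) k λ i i≢k → h (suc i) (i≢k ∘ FinP.suc-injective)))

  ∑-neg : (f : Fin n → ℤ) → sum (λ i → - f i) ≡ - sum f
  ∑-neg {zero}  f = refl
  ∑-neg {suc n} f = trans (cong (_+_ (- f zero)) (∑-neg (f ∘ suc))) (sym (ℤP.neg-distrib-+ (f zero) _))

  ∑-const : (c : ℤ) → sum {n} (λ _ → c) ≡ c * + n
  ∑-const {zero}  c = sym (ℤP.*-zeroʳ c)
  ∑-const {suc n} c = trans (cong (_+_ c) (∑-const c)) (ring c (+ n))
    where
    ring : ∀ c k → c + c * k ≡ c * (1ℤ + k)
    ring = solve-∀

  ∑-↑ : ∀ m {n} (f : Fin (m ℕ.+ n) → ℤ) → sum f ≡ sum (λ i → f (i ↑ˡ n)) + sum (λ j → f (m ↑ʳ j))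
  ∑-↑ zero    f = sym (ℤP.+-identityˡ _)
  ∑-↑ (suc m) f = trans (cong (_+_ (f zero)) (∑-↑ m (f ∘ suc))) (sym (ℤP.+-assoc (f zero) _ _))

  sumℤ-tabulate : (f : Fin n → ℤ) → sumℤ (tabulate f) ≡ sum f
  sumℤ-tabulate {zero}  f = refl
  sumℤ-tabulate {suc n} f = cong (_+_ (f zero)) (sumℤ-tabulate (f ∘ suc))

  -- Using does rather than ⌊_⌋ makes δ (suc i) (suc j) reduce to δ i j.
  δ : Fin n → Fin n → ℤ
  δ i j = if does (i ≟ j) then 1ℤ else 0ℤ

  δ-refl : (i : Fin n) → δ i i ≡ 1ℤ
  δ-refl i with i ≟ i
  ... | yes _  = refl
  ... | no i≢i = ⊥-elim (i≢i refl)

  δ-≢ : {i j : Fin n} → i ≢ j → δ i j ≡ 0ℤ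
  δ-≢ {i = i} {j} i≢j with i ≟ j
  ... | yes i≡j = ⊥-elim (i≢j i≡j)
  ... | no _    = refl

  δ-sym : (i j : Fin n) → δ i j ≡ δ j i
  δ-sym i j with i ≟ j | j ≟ i
  ... | yes _   | yes _   = refl
  ... | no _    | no _    = refl
  ... | yes i≡j | no j≢i  = ⊥-elim (j≢i (sym i≡j))
  ... | no i≢j  | yes j≡i = ⊥-elim (i≢j (sym j≡i))

  ∑-δ : (k : Fin n) (f : Fin n → ℤ) → sum (λ i → δ k i * f i) ≡ f k
  ∑-δ k f = trans (∑-single _ k λ i i≢k → trans (cong (_* f i) (δ-≢ (i≢k ∘ sym))) (ℤP.*-zeroˡ (f i)))
                  (trans (cong (_* f k) (δ-refl k)) (ℤP.*-identityˡ (f k)))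

  δ-cong-⇔ : ∀ {k l} {a b : Fin k} {c d : Fin l} → a ≡ b ⇔ c ≡ d → δ a b ≡ δ c d
  δ-cong-⇔ {a = a} {b} {c} {d} a≡b⇔c≡d with a ≟ b | c ≟ d
  ... | yes _   | yes _   = refl
  ... | no _    | no _    = refl
  ... | yes a≡b | no c≢d  = ⊥-elim (c≢d (Equivalence.to a≡b⇔c≡d a≡b))
  ... | no a≢b  | yes c≡d = ⊥-elim (a≢b (Equivalence.from a≡b⇔c≡d c≡d))

  if-≟ : ∀ x (a b : Fin n) → (if ⌊ a ≟ b ⌋ then x else 0ℤ) ≡ x * δ a b
  if-≟ x a b with a ≟ b
  ... | yes _ = sym (ℤP.*-identityʳ x)
  ... | no _  = sym (ℤP.*-zeroʳ x)

  δ-isYes : (a b : Fin n) → (if ⌊ a ≟ b ⌋ then 1ℤ else 0ℤ) ≡ δ a b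
  δ-isYes a b = trans (if-≟ 1ℤ a b) (ℤP.*-identityˡ (δ a b))

  δ-combine : ∀ {k l} (a c : Fin k) (b d : Fin l) → δ (combine a b) (combine c d) ≡ δ a c * δ b d
  δ-combine a c b d with a ≟ c | b ≟ d
  ... | yes refl | yes refl = δ-refl (combine a b)
  ... | no a≢c   | _        = δ-≢ (a≢c ∘ FinP.combine-injectiveˡ a b c d)
  ... | yes refl | no b≢d   = δ-≢ (b≢d ∘ FinP.combine-injectiveʳ a b a d)

  δ-combine-same : ∀ {k l} (h : Fin k) (a b : Fin l) → δ (combine h a) (combine h b) ≡ δ a b
  δ-combine-same h a b = trans (δ-combine h h a b) (trans (cong (_* δ a b) (δ-refl h)) (ℤP.*-identityˡ (δ a b)))

  sign-suc : ∀ k → sign (suc k) ≡ - sign k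
  sign-suc zero          = refl
  sign-suc (suc zero)    = refl
  sign-suc (suc (suc k)) = sign-suc k

  sign-exchange : ∀ k l a b d → sign (suc k) * a * (sign l * b * d) ≡ sign (suc l) * b * (sign k * a * d)
  sign-exchange k l a b d = begin
    sign (suc k) * a * (sign l * b * d) ≡⟨ cong (λ s → s * a * (sign l * b * d)) (sign-suc k) ⟩
    - sign k * a * (sign l * b * d)     ≡⟨ ring (sign k) (sign l) a b d ⟩
    - sign l * b * (sign k * a * d)     ≡⟨ cong (λ s → s * b * (sign k * a * d)) (sign-suc l) ⟨
    sign (suc l) * b * (sign k * a * d) ∎
    where
    open ≡-Reasoning
    ring : ∀ s t a b d → - s * a * (t * b * d) ≡ - t * b * (s * a * d)
    ring = solve-∀

  Mat : ℕ → Set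
  Mat n = Fin n → Fin n → ℤ

  _ᵀ : Mat n → Mat n
  (A ᵀ) i j = A j i

  minor : Fin (suc n) → Mat (suc n) → Mat n
  minor j A r c = A (suc r) (punchIn j c)

  laplaceTerm : Mat (suc n) → Fin (suc n) → ℤ
  laplaceTerm {n} A j = sign (toℕ j) * A zero j * det n (minor j A)

  det-laplace : (A : Mat (suc n)) → det (suc n) A ≡ sum (laplaceTerm A)
  det-laplace A = trans (cong sumℤ (map-tabulate id (laplaceTerm A))) (sumℤ-tabulate (laplaceTerm A))

  laplaceTerm-zero : (A : Mat (suc n)) (j : Fin (suc n)) → A zero j ≡ 0ℤ → laplaceTerm A j ≡ 0ℤ
  laplaceTerm-zero {n} A j A₀ⱼ≡0 = begin
    sign (toℕ j) * A zero j * det n (minor j A) ≡⟨ cong (λ a → sign (toℕ j) * a * det n (minor j A)) A₀ⱼ≡0 ⟩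
    sign (toℕ j) * 0ℤ * det n (minor j A)       ≡⟨ cong (_* det n (minor j A)) (ℤP.*-zeroʳ (sign (toℕ j))) ⟩
    0ℤ * det n (minor j A)                      ≡⟨ ℤP.*-zeroˡ (det n (minor j A)) ⟩
    0ℤ                                          ∎
    where open ≡-Reasoning

  det-cong : ∀ n {A B : Mat n} → (∀ i j → A i j ≡ B i j) → det n A ≡ det n B
  det-cong zero    _ = refl
  det-cong (suc n) {A} {B} A≗B = begin
    det (suc n) A          ≡⟨ det-laplace A ⟩
    sum (laplaceTerm A)    ≡⟨ sum-cong-≋ (λ j → cong₂ (λ a d → sign (toℕ j) * a * d) (A≗B zero j)
                                           (det-cong n λ r c → A≗B (suc r) (punchIn j c))) ⟩
    sum (laplaceTerm B)    ≡⟨ det-laplace B ⟨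
    det (suc n) B          ∎
    where open ≡-Reasoning

  -- Expanding along the first row, and then each minor along its first column (for A) or its
  -- first row (for Aᵀ), both determinants become A₀₀ det (minor zero A) plus the same double
  -- sum of the terms T i j.
  private
    det-ᵀ-step : ∀ n → (∀ A → det (suc n) (A ᵀ) ≡ det (suc n) A) → (∀ A → det n (A ᵀ) ≡ det n A) →
                 ∀ A → det (suc (suc n)) (A ᵀ) ≡ det (suc (suc n)) A
    det-ᵀ-step n det-ᵀ₁ det-ᵀ₀ A = begin
        det (suc (suc n)) (A ᵀ)
      ≡⟨ det-laplace (A ᵀ) ⟩
        laplaceTerm (A ᵀ) zero + sum (λ i → laplaceTerm (A ᵀ) (suc i))
      ≡⟨ cong₂ _+_ (cong (sign 0 * A zero zero *_) (det-ᵀ₁ (minor zero A))) (sum-cong-≋ rowSide) ⟩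
        laplaceTerm A zero + sum (λ i → sum (λ j → T i j))
      ≡⟨ cong (_+_ (laplaceTerm A zero)) (∑-comm T) ⟩
        laplaceTerm A zero + sum (λ j → sum (λ i → T i j))
      ≡⟨ cong (_+_ (laplaceTerm A zero)) (sum-cong-≋ columnSide) ⟨
        sum (laplaceTerm A)
      ≡⟨ det-laplace A ⟨
        det (suc (suc n)) A
      ∎
      where
      open ≡-Reasoning
      D : Fin (suc n) → Fin (suc n) → Mat n
      D i j r c = A (suc (punchIn i r)) (suc (punchIn j c))
      T : Fin (suc n) → Fin (suc n) → ℤ
      T i j = sign (suc (toℕ i)) * A (suc i) zero * (sign (toℕ j) * A zero (suc j) * det n (D i j))
      rowSide : ∀ i → laplaceTerm (A ᵀ) (suc i) ≡ sum (λ j → T i j)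
      rowSide i = trans (cong (sign (suc (toℕ i)) * A (suc i) zero *_) (trans (det-ᵀ₁ M) (det-laplace M)))
                        (*-distribˡ-sum (sign (suc (toℕ i)) * A (suc i) zero) (laplaceTerm M))
        where
        M : Mat (suc n)
        M r c = A (punchIn (suc i) r) (suc c)
      columnSide : ∀ j → laplaceTerm A (suc j) ≡ sum (λ i → T i j)
      columnSide j = begin
          sign (suc (toℕ j)) * A zero (suc j) * det (suc n) M
        ≡⟨ cong (sign (suc (toℕ j)) * A zero (suc j) *_) (trans (sym (det-ᵀ₁ M)) (det-laplace (M ᵀ))) ⟩
          sign (suc (toℕ j)) * A zero (suc j) * sum (laplaceTerm (M ᵀ))
        ≡⟨ *-distribˡ-sum (sign (suc (toℕ j)) * A zero (suc j)) (laplaceTerm (M ᵀ)) ⟩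
          sum (λ i → sign (suc (toℕ j)) * A zero (suc j) * laplaceTerm (M ᵀ) i)
        ≡⟨ sum-cong-≋ (λ i → trans (cong (λ d → sign (suc (toℕ j)) * A zero (suc j) * (sign (toℕ i) * A (suc i) zero * d))
                                          (det-ᵀ₀ (D i j)))
                                   (sign-exchange (toℕ j) (toℕ i) (A zero (suc j)) (A (suc i) zero) (det n (D i j)))) ⟩
          sum (λ i → T i j)
        ∎
        where
        M = minor (suc j) A

  det-ᵀ : ∀ n (A : Mat n) → det n (A ᵀ) ≡ det n A
  det-ᵀ zero          A = refl
  det-ᵀ (suc zero)    A = refl
  det-ᵀ (suc (suc n)) A = det-ᵀ-step n (det-ᵀ (suc n)) (det-ᵀ n) A

  det-linear-by-terms : (A B C : Mat (suc n)) (c : ℤ) →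
    (∀ j → laplaceTerm A j ≡ laplaceTerm B j + c * laplaceTerm C j) →
    det (suc n) A ≡ det (suc n) B + c * det (suc n) C
  det-linear-by-terms A B C c h = begin
    det _ A                                              ≡⟨ det-laplace A ⟩
    sum (laplaceTerm A)                                  ≡⟨ sum-cong-≋ h ⟩
    sum (λ j → laplaceTerm B j + c * laplaceTerm C j)    ≡⟨ ∑-distrib-+ (laplaceTerm B) (λ j → c * laplaceTerm C j) ⟩
    sum (laplaceTerm B) + sum (λ j → c * laplaceTerm C j) ≡⟨ cong₂ _+_ (det-laplace B) (*-distribˡ-sum c (laplaceTerm C)) ⟨
    det _ B + c * sum (laplaceTerm C)                    ≡⟨ cong (λ s → det _ B + c * s) (det-laplace C) ⟨
    det _ B + c * det _ C                                ∎
    where open ≡-Reasoning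

  det-row-linear : ∀ n (A B C : Mat n) (r : Fin n) (c : ℤ) →
    (∀ i j → i ≢ r → A i j ≡ B i j) → (∀ i j → i ≢ r → A i j ≡ C i j) →
    (∀ j → A r j ≡ B r j + c * C r j) → det n A ≡ det n B + c * det n C
  det-row-linear (suc n) A B C zero c A≗B A≗C rowᵣ = det-linear-by-terms A B C c λ j →
    begin
      sign (toℕ j) * A zero j * det n (minor j A)
    ≡⟨ cong₂ (λ a d → sign (toℕ j) * a * d) (rowᵣ j) (det-cong n λ r' c' → A≗B (suc r') (punchIn j c') λ ()) ⟩
      sign (toℕ j) * (B zero j + c * C zero j) * det n (minor j B)
    ≡⟨ ring (sign (toℕ j)) (B zero j) (C zero j) c (det n (minor j B)) ⟩
      laplaceTerm B j + c * (sign (toℕ j) * C zero j * det n (minor j B))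
    ≡⟨ cong (λ d → laplaceTerm B j + c * (sign (toℕ j) * C zero j * d))
            (det-cong n λ r' c' → trans (sym (A≗B (suc r') (punchIn j c') λ ())) (A≗C (suc r') (punchIn j c') λ ())) ⟩
      laplaceTerm B j + c * laplaceTerm C j
    ∎
    where
    open ≡-Reasoning
    ring : ∀ s b x c d → s * (b + c * x) * d ≡ s * b * d + c * (s * x * d)
    ring = solve-∀
  det-row-linear (suc n) A B C (suc r) c A≗B A≗C rowᵣ = det-linear-by-terms A B C c λ j →
    begin
      sign (toℕ j) * A zero j * det n (minor j A)
    ≡⟨ cong (sign (toℕ j) * A zero j *_)
            (det-row-linear n (minor j A) (minor j B) (minor j C) r c
              (λ i k i≢r → A≗B (suc i) (punchIn j k) (i≢r ∘ FinP.suc-injective))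
              (λ i k i≢r → A≗C (suc i) (punchIn j k) (i≢r ∘ FinP.suc-injective))
              (λ k → rowᵣ (punchIn j k))) ⟩
      sign (toℕ j) * A zero j * (det n (minor j B) + c * det n (minor j C))
    ≡⟨ ring (sign (toℕ j)) (A zero j) (det n (minor j B)) c (det n (minor j C)) ⟩
      sign (toℕ j) * A zero j * det n (minor j B) + c * (sign (toℕ j) * A zero j * det n (minor j C))
    ≡⟨ cong₂ (λ a a' → sign (toℕ j) * a * det n (minor j B) + c * (sign (toℕ j) * a' * det n (minor j C)))
             (A≗B zero j λ ()) (A≗C zero j λ ()) ⟩
      laplaceTerm B j + c * laplaceTerm C j
    ∎
    where
    open ≡-Reasoning
    ring : ∀ s a x c y → s * a * (x + c * y) ≡ s * a * x + c * (s * a * y)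
    ring = solve-∀

  swapAdj : Fin n → Fin (suc n) → Fin (suc n)
  swapAdj zero    zero          = suc zero
  swapAdj zero    (suc zero)    = zero
  swapAdj zero    (suc (suc j)) = suc (suc j)
  swapAdj (suc p) zero          = zero
  swapAdj (suc p) (suc j)       = suc (swapAdj p j)

  swapAdj-inject₁ : (p : Fin n) → swapAdj p (inject₁ p) ≡ suc p
  swapAdj-inject₁ zero    = refl
  swapAdj-inject₁ (suc p) = cong suc (swapAdj-inject₁ p)

  swapAdj-suc : (p : Fin n) → swapAdj p (suc p) ≡ inject₁ p
  swapAdj-suc zero    = refl
  swapAdj-suc (suc p) = cong suc (swapAdj-suc p)

  swapAdj-away : (p : Fin n) (j : Fin (suc n)) → j ≢ inject₁ p → j ≢ suc p → swapAdj p j ≡ j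
  swapAdj-away zero    zero          j≢p _    = ⊥-elim (j≢p refl)
  swapAdj-away zero    (suc zero)    _   j≢p' = ⊥-elim (j≢p' refl)
  swapAdj-away zero    (suc (suc j)) _   _    = refl
  swapAdj-away (suc p) zero          _   _    = refl
  swapAdj-away (suc p) (suc j)       j≢p j≢p' = cong suc (swapAdj-away p j (j≢p ∘ cong suc) (j≢p' ∘ cong suc))

  swapAdj-punchIn-inject₁ : (p : Fin n) (c : Fin n) → swapAdj p (punchIn (inject₁ p) c) ≡ punchIn (suc p) c
  swapAdj-punchIn-inject₁ zero    zero    = refl
  swapAdj-punchIn-inject₁ zero    (suc c) = refl
  swapAdj-punchIn-inject₁ (suc p) zero    = refl
  swapAdj-punchIn-inject₁ (suc p) (suc c) = cong suc (swapAdj-punchIn-inject₁ p c)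

  swapAdj-punchIn-suc : (p : Fin n) (c : Fin n) → swapAdj p (punchIn (suc p) c) ≡ punchIn (inject₁ p) c
  swapAdj-punchIn-suc zero    zero    = refl
  swapAdj-punchIn-suc zero    (suc c) = refl
  swapAdj-punchIn-suc (suc p) zero    = refl
  swapAdj-punchIn-suc (suc p) (suc c) = cong suc (swapAdj-punchIn-suc p c)

  swapAdj-punchIn-away : (p : Fin (suc n)) (j : Fin (suc (suc n))) → j ≢ inject₁ p → j ≢ suc p →
    Σ (Fin n) λ q → ∀ c → swapAdj p (punchIn j c) ≡ punchIn j (swapAdj q c)
  swapAdj-punchIn-away zero zero j≢p _ = ⊥-elim (j≢p refl)
  swapAdj-punchIn-away zero (suc zero) _ j≢p' = ⊥-elim (j≢p' refl)
  swapAdj-punchIn-away {suc n} zero (suc (suc j)) _ _ = zero , λ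
    { zero → refl ; (suc zero) → refl ; (suc (suc c)) → refl }
  swapAdj-punchIn-away (suc p) zero _ _ = p , λ c → refl
  swapAdj-punchIn-away {suc n} (suc p) (suc j) j≢p j≢p'
    with q , commute ← swapAdj-punchIn-away p j (j≢p ∘ cong suc) (j≢p' ∘ cong suc) =
    suc q , λ { zero → refl ; (suc c) → cong suc (commute c) }

  ∑-swapAdj : (p : Fin n) (f : Fin (suc n) → ℤ) → sum (f ∘ swapAdj p) ≡ sum f
  ∑-swapAdj {suc n} zero f = begin
    f (suc zero) + (f zero + rest) ≡⟨ ℤP.+-assoc (f (suc zero)) (f zero) rest ⟨
    f (suc zero) + f zero + rest   ≡⟨ cong (_+ rest) (ℤP.+-comm (f (suc zero)) (f zero)) ⟩
    f zero + f (suc zero) + rest   ≡⟨ ℤP.+-assoc (f zero) (f (suc zero)) rest ⟩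
    f zero + (f (suc zero) + rest) ∎
    where
    open ≡-Reasoning
    rest = sum {n} (λ i → f (suc (suc i)))
  ∑-swapAdj (suc p) f = cong (_+_ (f zero)) (∑-swapAdj p (f ∘ suc))

  swapColumns : Fin n → Mat (suc n) → Mat (suc n)
  swapColumns p A i j = A i (swapAdj p j)

  -- The terms at the two swapped columns trade places with opposite signs; every other term has
  -- a minor with two adjacent columns swapped.
  laplaceTerm-swapColumns : ∀ n (A : Mat (suc (suc n))) (p : Fin (suc n)) (j : Fin (suc (suc n))) →
    (∀ (B : Mat (suc n)) q → det (suc n) (swapColumns q B) ≡ - det (suc n) B) →
    laplaceTerm (swapColumns p A) j ≡ - laplaceTerm A (swapAdj p j)
  laplaceTerm-swapColumns n A p j det-swap with j ≟ inject₁ p | j ≟ suc p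
  ... | yes refl | _ = begin
      sign (toℕ (inject₁ p)) * A zero (swapAdj p (inject₁ p)) * det (suc n) (minor (inject₁ p) (swapColumns p A))
    ≡⟨ cong₂ (λ a d → sign (toℕ (inject₁ p)) * A zero a * d) (swapAdj-inject₁ p)
             (det-cong (suc n) λ r c → cong (A (suc r)) (swapAdj-punchIn-inject₁ p c)) ⟩
      sign (toℕ (inject₁ p)) * A zero (suc p) * det (suc n) (minor (suc p) A)
    ≡⟨ cong (λ s → sign s * A zero (suc p) * det (suc n) (minor (suc p) A)) (FinP.toℕ-inject₁ p) ⟩
      sign (toℕ p) * A zero (suc p) * det (suc n) (minor (suc p) A)
    ≡⟨ ring (sign (toℕ p)) (A zero (suc p)) (det (suc n) (minor (suc p) A)) ⟩
      - (- sign (toℕ p) * A zero (suc p) * det (suc n) (minor (suc p) A))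
    ≡⟨ cong (λ s → - (s * A zero (suc p) * det (suc n) (minor (suc p) A))) (sign-suc (toℕ p)) ⟨
      - laplaceTerm A (suc p)
    ≡⟨ cong (λ k → - laplaceTerm A k) (swapAdj-inject₁ p) ⟨
      - laplaceTerm A (swapAdj p (inject₁ p))
    ∎
    where
    open ≡-Reasoning
    ring : ∀ s a d → s * a * d ≡ - (- s * a * d)
    ring = solve-∀
  ... | no _ | yes refl = begin
      sign (suc (toℕ p)) * A zero (swapAdj p (suc p)) * det (suc n) (minor (suc p) (swapColumns p A))
    ≡⟨ cong₂ (λ a d → sign (suc (toℕ p)) * A zero a * d) (swapAdj-suc p)
             (det-cong (suc n) λ r c → cong (A (suc r)) (swapAdj-punchIn-suc p c)) ⟩
      sign (suc (toℕ p)) * A zero (inject₁ p) * det (suc n) (minor (inject₁ p) A)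
    ≡⟨ cong (λ s → s * A zero (inject₁ p) * det (suc n) (minor (inject₁ p) A)) (sign-suc (toℕ p)) ⟩
      - sign (toℕ p) * A zero (inject₁ p) * det (suc n) (minor (inject₁ p) A)
    ≡⟨ ring (sign (toℕ p)) (A zero (inject₁ p)) (det (suc n) (minor (inject₁ p) A)) ⟩
      - (sign (toℕ p) * A zero (inject₁ p) * det (suc n) (minor (inject₁ p) A))
    ≡⟨ cong (λ s → - (sign s * A zero (inject₁ p) * det (suc n) (minor (inject₁ p) A))) (FinP.toℕ-inject₁ p) ⟨
      - laplaceTerm A (inject₁ p)
    ≡⟨ cong (λ k → - laplaceTerm A k) (swapAdj-suc p) ⟨
      - laplaceTerm A (swapAdj p (suc p))
    ∎
    where
    open ≡-Reasoning
    ring : ∀ s a d → - s * a * d ≡ - (s * a * d)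
    ring = solve-∀
  laplaceTerm-swapColumns n A p j det-swap | no j≢p | no j≢p'
    with q , commute ← swapAdj-punchIn-away p j j≢p j≢p' = begin
      sign (toℕ j) * A zero (swapAdj p j) * det (suc n) (minor j (swapColumns p A))
    ≡⟨ cong₂ (λ k d → sign (toℕ j) * A zero k * d) (swapAdj-away p j j≢p j≢p')
             (det-cong (suc n) λ r c → cong (A (suc r)) (commute c)) ⟩
      sign (toℕ j) * A zero j * det (suc n) (swapColumns q (minor j A))
    ≡⟨ cong (sign (toℕ j) * A zero j *_) (det-swap (minor j A) q) ⟩
      sign (toℕ j) * A zero j * - det (suc n) (minor j A)
    ≡⟨ ring (sign (toℕ j)) (A zero j) (det (suc n) (minor j A)) ⟩
      - laplaceTerm A j
    ≡⟨ cong (λ k → - laplaceTerm A k) (swapAdj-away p j j≢p j≢p') ⟨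
      - laplaceTerm A (swapAdj p j)
    ∎
    where
    open ≡-Reasoning
    ring : ∀ s a d → s * a * - d ≡ - (s * a * d)
    ring = solve-∀

  det-swapColumns : ∀ n (A : Mat (suc n)) (p : Fin n) → det (suc n) (swapColumns p A) ≡ - det (suc n) A
  det-swapColumns (suc n) A p = begin
    det (suc (suc n)) (swapColumns p A)            ≡⟨ det-laplace (swapColumns p A) ⟩
    sum (laplaceTerm (swapColumns p A))            ≡⟨ sum-cong-≋ (λ j → laplaceTerm-swapColumns n A p j (det-swapColumns n)) ⟩
    sum (λ j → - laplaceTerm A (swapAdj p j))      ≡⟨ ∑-neg (laplaceTerm A ∘ swapAdj p) ⟩
    - sum (laplaceTerm A ∘ swapAdj p)              ≡⟨ cong -_ (∑-swapAdj p (laplaceTerm A)) ⟩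
    - sum (laplaceTerm A)                          ≡⟨ cong -_ (det-laplace A) ⟨
    - det (suc (suc n)) A                          ∎
    where open ≡-Reasoning

  i≡-i⇒i≡0 : ∀ i → i ≡ - i → i ≡ 0ℤ
  i≡-i⇒i≡0 i i≡-i = ℤP.*-cancelˡ-≡ (+ 2) i 0ℤ (begin
    + 2 * i  ≡⟨ ring i ⟩
    i + i    ≡⟨ cong (_+_ i) i≡-i ⟩
    i + - i  ≡⟨ ℤP.+-inverseʳ i ⟩
    0ℤ       ∎)
    where
    open ≡-Reasoning
    ring : ∀ i → + 2 * i ≡ i + i
    ring = solve-∀

  det-equal-adjacent-columns : ∀ n (A : Mat (suc n)) (p : Fin n) →
    (∀ i → A i (inject₁ p) ≡ A i (suc p)) → det (suc n) A ≡ 0ℤ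
  det-equal-adjacent-columns n A p equal =
    i≡-i⇒i≡0 (det (suc n) A) (trans (det-cong (suc n) unchanged) (det-swapColumns n A p))
    where
    unchanged : ∀ i j → A i j ≡ swapColumns p A i j
    unchanged i j with j ≟ inject₁ p | j ≟ suc p
    ... | yes refl | _        = trans (equal i) (sym (cong (A i) (swapAdj-inject₁ p)))
    ... | no _     | yes refl = trans (sym (equal i)) (sym (cong (A i) (swapAdj-suc p)))
    ... | no j≢p   | no j≢p'  = sym (cong (A i) (swapAdj-away p j j≢p j≢p'))

  -- Swapping the right-hand equal column one step to the left shortens the distance and only
  -- flips the sign.
  det-equal-columns-at-distance : ∀ d n (A : Mat (suc n)) (a : Fin (suc n)) (p : Fin n) →
    toℕ a ℕ.+ d ≡ toℕ p → (∀ i → A i a ≡ A i (suc p)) → det (suc n) A ≡ 0ℤ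
  det-equal-columns-at-distance zero n A a p a+0≡p equal =
    det-equal-adjacent-columns n A p λ i → trans (cong (A i) (sym a≡p)) (equal i)
    where
    a≡p : a ≡ inject₁ p
    a≡p = FinP.toℕ-injective (trans (sym (ℕP.+-identityʳ (toℕ a))) (trans a+0≡p (sym (FinP.toℕ-inject₁ p))))
  det-equal-columns-at-distance (suc d) (suc n) A a (suc p) a+d≡p equal = begin
    det (suc (suc n)) A                        ≡⟨ ℤP.neg-involutive _ ⟨
    - - det (suc (suc n)) A                    ≡⟨ cong -_ (det-swapColumns (suc n) A (suc p)) ⟨
    - det (suc (suc n)) (swapColumns (suc p) A) ≡⟨ cong -_ swapped-det ⟩
    0ℤ                                         ∎
    where
    open ≡-Reasoning
    a<p : toℕ a ℕ.< toℕ (suc p)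
    a<p = subst (toℕ a ℕ.<_) a+d≡p (ℕP.m<m+n (toℕ a) (ℕ.s≤s ℕ.z≤n))
    a-away : ∀ j → toℕ (suc p) ℕ.≤ toℕ j → a ≢ j
    a-away j p≤j refl = ℕP.<⇒≱ a<p p≤j
    swapped-det : det (suc (suc n)) (swapColumns (suc p) A) ≡ 0ℤ
    swapped-det = det-equal-columns-at-distance d (suc n) (swapColumns (suc p) A) a (inject₁ p)
      (trans (ℕP.suc-injective (trans (sym (ℕP.+-suc (toℕ a) d)) a+d≡p)) (sym (FinP.toℕ-inject₁ p)))
      λ i → begin
        A i (swapAdj (suc p) a)     ≡⟨ cong (A i) (swapAdj-away (suc p) a
                                         (a-away (inject₁ (suc p)) (ℕP.≤-reflexive (sym (FinP.toℕ-inject₁ (suc p)))))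
                                         (a-away (suc (suc p)) (ℕP.n≤1+n _))) ⟩
        A i a                       ≡⟨ equal i ⟩
        A i (suc (suc p))           ≡⟨ cong (A i) (swapAdj-inject₁ (suc p)) ⟨
        A i (swapAdj (suc p) (inject₁ (suc p))) ∎
  det-equal-columns-at-distance (suc d) n A a zero a+d≡0 _ =
    ⊥-elim (ℕP.1+n≢0 (trans (sym (ℕP.+-suc (toℕ a) d)) a+d≡0))

  det-equal-columns : ∀ n (A : Mat n) (a b : Fin n) → toℕ a ℕ.< toℕ b → (∀ i → A i a ≡ A i b) → det n A ≡ 0ℤ
  det-equal-columns (suc n) A a (suc p) a<b =
    det-equal-columns-at-distance (toℕ p ℕ.∸ toℕ a) n A a p (ℕP.m+[n∸m]≡n (ℕ.s≤s⁻¹ a<b))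

  det-equal-rows : ∀ n (A : Mat n) (a b : Fin n) → a ≢ b → (∀ j → A a j ≡ A b j) → det n A ≡ 0ℤ
  det-equal-rows n A a b a≢b equal with ℕP.<-cmp (toℕ a) (toℕ b)
  ... | tri< a<b _ _ = trans (sym (det-ᵀ n A)) (det-equal-columns n (A ᵀ) a b a<b equal)
  ... | tri≈ _ a≡b _ = ⊥-elim (a≢b (FinP.toℕ-injective a≡b))
  ... | tri> _ _ b<a = trans (sym (det-ᵀ n A)) (det-equal-columns n (A ᵀ) b a b<a (sym ∘ equal))

  replaceRow : Fin n → (Fin n → ℤ) → Mat n → Mat n
  replaceRow r v A i j = if ⌊ i ≟ r ⌋ then v j else A i j

  replaceRow-here : (r : Fin n) (v : Fin n → ℤ) (A : Mat n) (j : Fin n) → replaceRow r v A r j ≡ v j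
  replaceRow-here r v A j with r ≟ r
  ... | yes _  = refl
  ... | no r≢r = ⊥-elim (r≢r refl)

  replaceRow-elsewhere : (r : Fin n) (v : Fin n → ℤ) (A : Mat n) (i j : Fin n) → i ≢ r → replaceRow r v A i j ≡ A i j
  replaceRow-elsewhere r v A i j i≢r with i ≟ r
  ... | yes i≡r = ⊥-elim (i≢r i≡r)
  ... | no _    = refl

  det-add-row-combination : ∀ n m (A A' : Mat n) (r : Fin n) (c : Fin m → ℤ) (σ : Fin m → Fin n) →
    (∀ k → σ k ≡ r → c k ≡ 0ℤ) → (∀ i j → i ≢ r → A' i j ≡ A i j) →
    (∀ j → A' r j ≡ A r j + sum (λ k → c k * A (σ k) j)) → det n A' ≡ det n A
  det-add-row-combination n zero A A' r c σ _ others rowᵣ = det-cong n same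
    where
    same : ∀ i j → A' i j ≡ A i j
    same i j with i ≟ r
    ... | yes refl = trans (rowᵣ j) (ℤP.+-identityʳ (A i j))
    ... | no i≢r   = others i j i≢r
  det-add-row-combination n (suc m) A A' r c σ σ≡r⇒c≡0 others rowᵣ = begin
    det n A'                         ≡⟨ det-row-linear n A' A″ C r (c zero) (A'≗ restRow) (A'≗ (A (σ zero))) split ⟩
    det n A″ + c zero * det n C      ≡⟨ cong₂ _+_ rest copied ⟩
    det n A + 0ℤ                     ≡⟨ ℤP.+-identityʳ (det n A) ⟩
    det n A                          ∎
    where
    open ≡-Reasoning
    rest-sum restRow : Fin n → ℤ
    rest-sum j = sum (λ k → c (suc k) * A (σ (suc k)) j)
    restRow j = A r j + rest-sum j
    A″ C : Mat n
    A″ = replaceRow r restRow A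
    C  = replaceRow r (A (σ zero)) A
    A'≗ : ∀ v i j → i ≢ r → A' i j ≡ replaceRow r v A i j
    A'≗ v i j i≢r = trans (others i j i≢r) (sym (replaceRow-elsewhere r v A i j i≢r))
    ring : ∀ a x y → a + (x + y) ≡ a + y + x
    ring = solve-∀
    split : ∀ j → A' r j ≡ A″ r j + c zero * C r j
    split j = begin
      A' r j                                        ≡⟨ rowᵣ j ⟩
      A r j + (c zero * A (σ zero) j + rest-sum j)  ≡⟨ ring (A r j) (c zero * A (σ zero) j) (rest-sum j) ⟩
      restRow j + c zero * A (σ zero) j             ≡⟨ cong₂ (λ x y → x + c zero * y) (replaceRow-here r restRow A j)
                                                                                     (replaceRow-here r (A (σ zero)) A j) ⟨
      A″ r j + c zero * C r j                       ∎
    rest : det n A″ ≡ det n A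
    rest = det-add-row-combination n m A A″ r (c ∘ suc) (σ ∘ suc) (σ≡r⇒c≡0 ∘ suc)
             (replaceRow-elsewhere r restRow A) (replaceRow-here r restRow A)
    copied : c zero * det n C ≡ 0ℤ
    copied with σ zero ≟ r
    ... | yes σ₀≡r = trans (cong (_* det n C) (σ≡r⇒c≡0 zero σ₀≡r)) (ℤP.*-zeroˡ (det n C))
    ... | no σ₀≢r  = trans (cong (c zero *_) (det-equal-rows n C r (σ zero) (σ₀≢r ∘ sym) λ j →
                       trans (replaceRow-here r (A (σ zero)) A j) (sym (replaceRow-elsewhere r (A (σ zero)) A (σ zero) j σ₀≢r))))
                           (ℤP.*-zeroʳ (c zero))

  ifBelow : ℕ → Fin n → ℤ → ℤ
  ifBelow k i x = if ⌊ toℕ i ℕ.<? k ⌋ then x else 0ℤ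

  ifBelow-< : ∀ k (i : Fin n) x → toℕ i ℕ.< k → ifBelow k i x ≡ x
  ifBelow-< k i x i<k with toℕ i ℕ.<? k
  ... | yes _   = refl
  ... | no i≮k  = ⊥-elim (i≮k i<k)

  ifBelow-≮ : ∀ k (i : Fin n) x → ¬ toℕ i ℕ.< k → ifBelow k i x ≡ 0ℤ
  ifBelow-≮ k i x i≮k with toℕ i ℕ.<? k
  ... | yes i<k = ⊥-elim (i≮k i<k)
  ... | no _    = refl

  ifBelow-suc : ∀ k (i : Fin n) x → toℕ i ≢ k → ifBelow (suc k) i x ≡ ifBelow k i x
  ifBelow-suc k i x i≢k with toℕ i ℕ.<? k
  ... | yes i<k = ifBelow-< (suc k) i x (ℕP.m<n⇒m<1+n i<k)
  ... | no i≮k  = ifBelow-≮ (suc k) i x λ i<1+k → i≮k (ℕP.≤∧≢⇒< (ℕ.s≤s⁻¹ i<1+k) i≢k)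

  *-ifBelow : ∀ k (i : Fin n) x c → c * x ≡ 0ℤ → c * ifBelow k i x ≡ 0ℤ
  *-ifBelow k i x c cx≡0 with toℕ i ℕ.<? k
  ... | yes _ = cx≡0
  ... | no _  = ℤP.*-zeroʳ c

  -- Rows are updated one at a time: partial k has the rows below k updated. As C r s * C s t ≡ 0,
  -- every row that row k draws from has a zero combination of its own, so each step adds a
  -- combination of current rows.
  det-add-nilpotent-row-combination : ∀ n (A C : Mat n) → (∀ r s t → C r s * C s t ≡ 0ℤ) →
    det n (λ i j → A i j + sum (λ s → C i s * A s j)) ≡ det n A
  det-add-nilpotent-row-combination n A C C²≡0 = begin
    det n (λ i j → A i j + R i j)  ≡⟨ det-cong n (λ i j → cong (_+_ (A i j)) (ifBelow-< n i (R i j) (FinP.toℕ<n i))) ⟨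
    det n (partial n)              ≡⟨ partial-det n ℕP.≤-refl ⟩
    det n A                        ∎
    where
    open ≡-Reasoning
    R : Mat n
    R i j = sum (λ s → C i s * A s j)
    partial : ℕ → Mat n
    partial k i j = A i j + ifBelow k i (R i j)
    Cᵣᵣ≡0 : ∀ r → C r r ≡ 0ℤ
    Cᵣᵣ≡0 r = [ id , id ]′ (ℤP.i*j≡0⇒i≡0∨j≡0 (C r r) (C²≡0 r r r))
    CR≡0 : ∀ r s j → C r s * R s j ≡ 0ℤ
    CR≡0 r s j = trans (*-distribˡ-sum (C r s) (λ t → C s t * A t j))
                       (∑-zero λ t → trans (sym (ℤP.*-assoc (C r s) (C s t) (A t j)))
                                          (trans (cong (_* A t j) (C²≡0 r s t)) (ℤP.*-zeroˡ (A t j))))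
    partial-det : ∀ k → k ℕ.≤ n → det n (partial k) ≡ det n A
    partial-det zero    _   = det-cong n λ i j → ℤP.+-identityʳ (A i j)
    partial-det (suc k) k<n = trans (det-add-row-combination n n (partial k) (partial (suc k)) r (C r) id
                                       (λ s s≡r → trans (cong (C r) s≡r) (Cᵣᵣ≡0 r)) others rowᵣ)
                                    (partial-det k (ℕP.<⇒≤ k<n))
      where
      r : Fin n
      r = Fin.fromℕ< k<n
      r≡k : toℕ r ≡ k
      r≡k = FinP.toℕ-fromℕ< k<n
      others : ∀ i j → i ≢ r → partial (suc k) i j ≡ partial k i j
      others i j i≢r = cong (_+_ (A i j)) (ifBelow-suc k i (R i j) λ i≡k → i≢r (FinP.toℕ-injective (trans i≡k (sym r≡k))))
      rowᵣ : ∀ j → partial (suc k) r j ≡ partial k r j + sum (λ s → C r s * partial k s j)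
      rowᵣ j = begin
        A r j + ifBelow (suc k) r (R r j)
          ≡⟨ cong (_+_ (A r j)) (ifBelow-< (suc k) r (R r j) (ℕP.≤-reflexive (cong suc r≡k))) ⟩
        A r j + R r j
          ≡⟨ cong₂ _+_ (ℤP.+-identityʳ (A r j)) (ℤP.+-identityʳ (R r j)) ⟨
        A r j + 0ℤ + (R r j + 0ℤ)
          ≡⟨ cong₂ (λ x y → A r j + x + (R r j + y))
                   (ifBelow-≮ k r (R r j) (ℕP.<-irrefl r≡k))
                   (∑-zero λ s → *-ifBelow k s (R s j) (C r s) (CR≡0 r s j)) ⟨
        partial k r j + (R r j + sum (λ s → C r s * ifBelow k s (R s j)))
          ≡⟨ cong (_+_ (partial k r j)) (∑-distrib-+ (λ s → C r s * A s j) (λ s → C r s * ifBelow k s (R s j))) ⟨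
        partial k r j + sum (λ s → C r s * A s j + C r s * ifBelow k s (R s j))
          ≡⟨ cong (_+_ (partial k r j)) (sum-cong-≋ λ s → ℤP.*-distribˡ-+ (C r s) (A s j) _) ⟨
        partial k r j + sum (λ s → C r s * partial k s j)
          ∎

  det-add-nilpotent-column-combination : ∀ n (A C : Mat n) → (∀ r s t → C r s * C s t ≡ 0ℤ) →
    det n (λ i j → A i j + sum (λ s → C j s * A i s)) ≡ det n A
  det-add-nilpotent-column-combination n A C C²≡0 =
    trans (sym (det-ᵀ n _)) (trans (det-add-nilpotent-row-combination n (A ᵀ) C C²≡0) (det-ᵀ n A))

  det-first-row-zero : ∀ n (A : Mat (suc n)) → (∀ j → A zero (suc j) ≡ 0ℤ) →
    det (suc n) A ≡ A zero zero * det n (minor zero A)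
  det-first-row-zero n A row₀ = begin
    det (suc n) A                           ≡⟨ det-laplace A ⟩
    laplaceTerm A zero + sum (λ j → laplaceTerm A (suc j))
      ≡⟨ cong (_+_ (laplaceTerm A zero)) (∑-zero λ j → laplaceTerm-zero A (suc j) (row₀ j)) ⟩
    laplaceTerm A zero + 0ℤ                 ≡⟨ ℤP.+-identityʳ _ ⟩
    1ℤ * A zero zero * det n (minor zero A) ≡⟨ cong (_* det n (minor zero A)) (ℤP.*-identityˡ (A zero zero)) ⟩
    A zero zero * det n (minor zero A)      ∎
    where open ≡-Reasoning

  det-first-column-zero : ∀ n (A : Mat (suc n)) → (∀ i → A (suc i) zero ≡ 0ℤ) →
    det (suc n) A ≡ A zero zero * det n (minor zero A)
  det-first-column-zero n A column₀ = begin
    det (suc n) A                              ≡⟨ det-ᵀ (suc n) A ⟨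
    det (suc n) (A ᵀ)                          ≡⟨ det-first-row-zero n (A ᵀ) column₀ ⟩
    A zero zero * det n (minor zero A ᵀ)       ≡⟨ cong (A zero zero *_) (det-ᵀ n (minor zero A)) ⟩
    A zero zero * det n (minor zero A)         ∎
    where open ≡-Reasoning

  det-scalar : ∀ n (y : ℤ) → det n (λ i j → y * δ i j) ≡ y ^ n
  det-scalar zero    y = refl
  det-scalar (suc n) y = begin
    det (suc n) (λ i j → y * δ i j)           ≡⟨ det-first-row-zero n (λ i j → y * δ i j) (λ _ → ℤP.*-zeroʳ y) ⟩
    y * 1ℤ * det n (λ i j → y * δ i j)        ≡⟨ cong₂ _*_ (ℤP.*-identityʳ y) (det-scalar n y) ⟩
    y * y ^ n                                 ∎
    where open ≡-Reasoning

  punchIn-↑ˡ : ∀ {m} n (j : Fin (suc m)) (k : Fin m) → punchIn (j ↑ˡ n) (k ↑ˡ n) ≡ punchIn j k ↑ˡ n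
  punchIn-↑ˡ n zero    k       = refl
  punchIn-↑ˡ n (suc j) zero    = refl
  punchIn-↑ˡ n (suc j) (suc k) = cong suc (punchIn-↑ˡ n j k)

  punchIn-↑ʳ : ∀ {m} n (j : Fin (suc m)) (k : Fin n) → punchIn (j ↑ˡ n) (m ↑ʳ k) ≡ suc m ↑ʳ k
  punchIn-↑ʳ         n zero    k = refl
  punchIn-↑ʳ {suc m} n (suc j) k = cong suc (punchIn-↑ʳ n j k)

  det-block-lower-triangular : ∀ m n (Z : Mat (m ℕ.+ n)) → (∀ i j → Z (i ↑ˡ n) (m ↑ʳ j) ≡ 0ℤ) →
    det (m ℕ.+ n) Z ≡ det m (λ i j → Z (i ↑ˡ n) (j ↑ˡ n)) * det n (λ i j → Z (m ↑ʳ i) (m ↑ʳ j))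
  det-block-lower-triangular zero    n Z _ = sym (ℤP.*-identityˡ _)
  det-block-lower-triangular (suc m) n Z upper≡0 = begin
    det (suc m ℕ.+ n) Z
      ≡⟨ det-laplace Z ⟩
    sum (laplaceTerm Z)
      ≡⟨ ∑-↑ (suc m) (laplaceTerm Z) ⟩
    sum (λ j → laplaceTerm Z (j ↑ˡ n)) + sum (λ j → laplaceTerm Z (suc m ↑ʳ j))
      ≡⟨ cong₂ _+_ (sum-cong-≋ left) (∑-zero λ j → laplaceTerm-zero Z (suc m ↑ʳ j) (upper≡0 zero j)) ⟩
    sum (λ j → laplaceTerm P j * det n Q) + 0ℤ
      ≡⟨ ℤP.+-identityʳ _ ⟩
    sum (λ j → laplaceTerm P j * det n Q)
      ≡⟨ sum-cong-≋ (λ j → ℤP.*-comm (laplaceTerm P j) (det n Q)) ⟩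
    sum (λ j → det n Q * laplaceTerm P j)
      ≡⟨ *-distribˡ-sum (det n Q) (laplaceTerm P) ⟨
    det n Q * sum (laplaceTerm P)
      ≡⟨ trans (cong (_* det n Q) (det-laplace P)) (ℤP.*-comm (sum (laplaceTerm P)) (det n Q)) ⟨
    det (suc m) P * det n Q
      ∎
    where
    open ≡-Reasoning
    P : Mat (suc m)
    P i j = Z (i ↑ˡ n) (j ↑ˡ n)
    Q : Mat n
    Q i j = Z (suc m ↑ʳ i) (suc m ↑ʳ j)
    left : ∀ j → laplaceTerm Z (j ↑ˡ n) ≡ laplaceTerm P j * det n Q
    left j = begin
        sign (toℕ (j ↑ˡ n)) * P zero j * det (m ℕ.+ n) (minor (j ↑ˡ n) Z)
      ≡⟨ cong₂ (λ k d → sign k * P zero j * d) (FinP.toℕ-↑ˡ j n)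
               (det-block-lower-triangular m n (minor (j ↑ˡ n) Z)
                 λ a b → trans (cong (Z (suc a ↑ˡ n)) (punchIn-↑ʳ n j b)) (upper≡0 (suc a) b)) ⟩
        sign (toℕ j) * P zero j * (det m (λ a b → Z (suc a ↑ˡ n) (punchIn (j ↑ˡ n) (b ↑ˡ n)))
                                   * det n (λ a b → Z (suc (m ↑ʳ a)) (punchIn (j ↑ˡ n) (m ↑ʳ b))))
      ≡⟨ cong₂ (λ d d' → sign (toℕ j) * P zero j * (d * d'))
               (det-cong m λ a b → cong (Z (suc a ↑ˡ n)) (punchIn-↑ˡ n j b))
               (det-cong n λ a b → cong (Z (suc (m ↑ʳ a))) (punchIn-↑ʳ n j b)) ⟩
        sign (toℕ j) * P zero j * (det m (minor j P) * det n Q)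
      ≡⟨ ℤP.*-assoc (sign (toℕ j) * P zero j) _ _ ⟨
        laplaceTerm P j * det n Q
      ∎

  -- Adding the lower rows to the upper ones and then subtracting the left columns from the right
  -- ones turns [[P, Q], [Q, P]] into [[P + Q, 0], [Q, P − Q]].
  det-block-symmetric : ∀ n (Z : Mat (n ℕ.+ n)) (P Q : Mat n) →
    (∀ i j → Z (i ↑ˡ n) (j ↑ˡ n) ≡ P i j) → (∀ i j → Z (i ↑ˡ n) (n ↑ʳ j) ≡ Q i j) →
    (∀ i j → Z (n ↑ʳ i) (j ↑ˡ n) ≡ Q i j) → (∀ i j → Z (n ↑ʳ i) (n ↑ʳ j) ≡ P i j) →
    det (n ℕ.+ n) Z ≡ det n (λ i j → P i j + Q i j) * det n (λ i j → P i j - Q i j)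
  det-block-symmetric n Z P Q Z₀₀ Z₀₁ Z₁₀ Z₁₁ = begin
    det N Z
      ≡⟨ det-add-nilpotent-row-combination N Z C C²≡0 ⟨
    det N Z₁
      ≡⟨ det-add-nilpotent-column-combination N Z₁ C' C'²≡0 ⟨
    det N Z₂
      ≡⟨ det-block-lower-triangular n n Z₂ upperRight ⟩
    det n (λ i j → Z₂ (top i) (top j)) * det n (λ i j → Z₂ (bot i) (bot j))
      ≡⟨ cong₂ _*_ (det-cong n upperLeft) (det-cong n lowerRight) ⟩
    det n (λ i j → P i j + Q i j) * det n (λ i j → P i j - Q i j)
      ∎
    where
    open ≡-Reasoning
    N = n ℕ.+ n
    top bot : Fin n → Fin N
    top i = i ↑ˡ n
    bot i = n ↑ʳ i
    C C' : Mat N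
    C r s  = [ (λ i → δ (bot i) s) , (λ _ → 0ℤ) ]′ (splitAt n r)
    C' r s = [ (λ _ → 0ℤ) , (λ i → - δ (top i) s) ]′ (splitAt n r)
    C-top : ∀ i s → C (top i) s ≡ δ (bot i) s
    C-top i s = cong [ (λ i → δ (bot i) s) , (λ _ → 0ℤ) ]′ (FinP.splitAt-↑ˡ n i n)
    C-bot : ∀ i s → C (bot i) s ≡ 0ℤ
    C-bot i s = cong [ (λ i → δ (bot i) s) , (λ _ → 0ℤ) ]′ (FinP.splitAt-↑ʳ n n i)
    C'-top : ∀ i s → C' (top i) s ≡ 0ℤ
    C'-top i s = cong [ (λ _ → 0ℤ) , (λ i → - δ (top i) s) ]′ (FinP.splitAt-↑ˡ n i n)
    C'-bot : ∀ i s → C' (bot i) s ≡ - δ (top i) s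
    C'-bot i s = cong [ (λ _ → 0ℤ) , (λ i → - δ (top i) s) ]′ (FinP.splitAt-↑ʳ n n i)
    C²≡0 : ∀ r s t → C r s * C s t ≡ 0ℤ
    C²≡0 r s t with splitAt n r
    ... | inj₂ _ = refl
    ... | inj₁ i with bot i ≟ s
    ...   | yes refl = cong (1ℤ *_) (C-bot i t)
    ...   | no _     = refl
    C'²≡0 : ∀ r s t → C' r s * C' s t ≡ 0ℤ
    C'²≡0 r s t with splitAt n r
    ... | inj₁ _ = refl
    ... | inj₂ i with top i ≟ s
    ...   | yes refl = cong (-1ℤ *_) (C'-top i t)
    ...   | no _     = refl
    Z₁ Z₂ : Mat N
    Z₁ i j = Z i j + sum (λ s → C i s * Z s j)
    Z₂ i j = Z₁ i j + sum (λ s → C' j s * Z₁ i s)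
    Z₁-top : ∀ i j → Z₁ (top i) j ≡ Z (top i) j + Z (bot i) j
    Z₁-top i j = cong (_+_ (Z (top i) j))
      (trans (sum-cong-≋ λ s → cong (_* Z s j) (C-top i s)) (∑-δ (bot i) (λ s → Z s j)))
    Z₁-bot : ∀ i j → Z₁ (bot i) j ≡ Z (bot i) j
    Z₁-bot i j = trans (cong (_+_ (Z (bot i) j)) (∑-zero λ s → cong (_* Z s j) (C-bot i s)))
                       (ℤP.+-identityʳ (Z (bot i) j))
    Z₂-top : ∀ i j → Z₂ i (top j) ≡ Z₁ i (top j)
    Z₂-top i j = trans (cong (_+_ (Z₁ i (top j))) (∑-zero λ s → cong (_* Z₁ i s) (C'-top j s)))
                       (ℤP.+-identityʳ (Z₁ i (top j)))
    Z₂-bot : ∀ i j → Z₂ i (bot j) ≡ Z₁ i (bot j) - Z₁ i (top j)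
    Z₂-bot i j = cong (_+_ (Z₁ i (bot j))) (begin
      sum (λ s → C' (bot j) s * Z₁ i s)      ≡⟨ sum-cong-≋ (λ s → trans (cong (_* Z₁ i s) (C'-bot j s))
                                                                      (sym (ℤP.neg-distribˡ-* (δ (top j) s) (Z₁ i s)))) ⟩
      sum (λ s → - (δ (top j) s * Z₁ i s))   ≡⟨ ∑-neg (λ s → δ (top j) s * Z₁ i s) ⟩
      - sum (λ s → δ (top j) s * Z₁ i s)     ≡⟨ cong -_ (∑-δ (top j) (Z₁ i)) ⟩
      - Z₁ i (top j)                         ∎)
    upperLeft : ∀ i j → Z₂ (top i) (top j) ≡ P i j + Q i j
    upperLeft i j = trans (Z₂-top (top i) j) (trans (Z₁-top i (top j)) (cong₂ _+_ (Z₀₀ i j) (Z₁₀ i j)))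
    upperRight : ∀ i j → Z₂ (top i) (bot j) ≡ 0ℤ
    upperRight i j = begin
      Z₂ (top i) (bot j)                      ≡⟨ Z₂-bot (top i) j ⟩
      Z₁ (top i) (bot j) - Z₁ (top i) (top j) ≡⟨ cong₂ _-_ (Z₁-top i (bot j)) (Z₁-top i (top j)) ⟩
      (Z (top i) (bot j) + Z (bot i) (bot j)) - (Z (top i) (top j) + Z (bot i) (top j))
        ≡⟨ cong₂ (λ x y → x - y) (cong₂ _+_ (Z₀₁ i j) (Z₁₁ i j)) (cong₂ _+_ (Z₀₀ i j) (Z₁₀ i j)) ⟩
      (Q i j + P i j) - (P i j + Q i j)       ≡⟨ ring (P i j) (Q i j) ⟩
      0ℤ                                      ∎
      where
      ring : ∀ p q → (q + p) - (p + q) ≡ 0ℤ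
      ring = solve-∀
    lowerRight : ∀ i j → Z₂ (bot i) (bot j) ≡ P i j - Q i j
    lowerRight i j = trans (Z₂-bot (bot i) j)
                           (cong₂ _-_ (trans (Z₁-bot i (bot j)) (Z₁₁ i j)) (trans (Z₁-bot i (top j)) (Z₁₀ i j)))

  -- Subtracting u r u₀ times row 0 from each row r > 0 and then adding u s u₀ times column s to
  -- column 0 leaves y + c (m + 1) in the corner, zeros below it, and y I as its minor (as u₀² = 1).
  det-scalar-plus-rank-one : ∀ m (y c : ℤ) (u : Fin (suc m) → ℤ) → (∀ i → u i * u i ≡ 1ℤ) →
    det (suc m) (λ i j → y * δ i j + c * (u i * u j)) ≡ y ^ m * (y + c * + suc m)
  det-scalar-plus-rank-one m y c u u²≡1 = begin
    det (suc m) Z                              ≡⟨ det-add-nilpotent-row-combination (suc m) Z C C²≡0 ⟨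
    det (suc m) Z₁                             ≡⟨ det-add-nilpotent-column-combination (suc m) Z₁ C' C'²≡0 ⟨
    det (suc m) Z₂                             ≡⟨ det-first-column-zero m Z₂ Z₂-column₀ ⟩
    Z₂ zero zero * det m (minor zero Z₂)       ≡⟨ cong₂ _*_ Z₂-corner (trans (det-cong m Z₂-minor) (det-scalar m y)) ⟩
    (y + c * + suc m) * y ^ m                  ≡⟨ ℤP.*-comm (y + c * + suc m) (y ^ m) ⟩
    y ^ m * (y + c * + suc m)                  ∎
    where
    open ≡-Reasoning
    Z : Mat (suc m)
    Z i j = y * δ i j + c * (u i * u j)
    u₀ = u zero
    C C' : Mat (suc m)
    C zero    _       = 0ℤ
    C (suc r) zero    = - (u (suc r) * u₀)
    C (suc r) (suc _) = 0ℤ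
    C' zero    zero    = 0ℤ
    C' zero    (suc s) = u (suc s) * u₀
    C' (suc _) _       = 0ℤ
    C²≡0 : ∀ r s t → C r s * C s t ≡ 0ℤ
    C²≡0 r       zero    t = ℤP.*-zeroʳ (C r zero)
    C²≡0 zero    (suc s) t = refl
    C²≡0 (suc r) (suc s) t = refl
    C'²≡0 : ∀ r s t → C' r s * C' s t ≡ 0ℤ
    C'²≡0 r       (suc s) t = ℤP.*-zeroʳ (C' r (suc s))
    C'²≡0 zero    zero    t = refl
    C'²≡0 (suc r) zero    t = refl
    Z₁ Z₂ : Mat (suc m)
    Z₁ i j = Z i j + sum (λ s → C i s * Z s j)
    Z₂ i j = Z₁ i j + sum (λ s → C' j s * Z₁ i s)
    Z₁-row₀ : ∀ j → Z₁ zero j ≡ Z zero j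
    Z₁-row₀ j = trans (cong (_+_ (Z zero j)) (∑-zero {f = λ s → C zero s * Z s j} λ _ → refl)) (ℤP.+-identityʳ (Z zero j))
    Z₁-row : ∀ r j → Z₁ (suc r) j ≡ y * δ (suc r) j - u (suc r) * u₀ * (y * δ zero j)
    Z₁-row r j = begin
      Z (suc r) j + (- (u (suc r) * u₀) * Z zero j + sum {m} (λ _ → 0ℤ))
        ≡⟨ cong (λ s → Z (suc r) j + (- (u (suc r) * u₀) * Z zero j + s)) (∑-zero {m} λ _ → refl) ⟩
      Z (suc r) j + (- (u (suc r) * u₀) * Z zero j + 0ℤ)
        ≡⟨ ring (y * δ (suc r) j) c (u (suc r)) (u j) u₀ (y * δ zero j) ⟩
      y * δ (suc r) j - u (suc r) * u₀ * (y * δ zero j) + c * u (suc r) * u j * (1ℤ - u₀ * u₀)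
        ≡⟨ cong (λ s → y * δ (suc r) j - u (suc r) * u₀ * (y * δ zero j) + c * u (suc r) * u j * (1ℤ - s)) (u²≡1 zero) ⟩
      y * δ (suc r) j - u (suc r) * u₀ * (y * δ zero j) + c * u (suc r) * u j * (1ℤ - 1ℤ)
        ≡⟨ ring′ (y * δ (suc r) j - u (suc r) * u₀ * (y * δ zero j)) (c * u (suc r) * u j) ⟩
      y * δ (suc r) j - u (suc r) * u₀ * (y * δ zero j)
        ∎
      where
      ring : ∀ a c uᵣ uⱼ u₀ b → a + c * (uᵣ * uⱼ) + (- (uᵣ * u₀) * (b + c * (u₀ * uⱼ)) + 0ℤ)
                                ≡ a - uᵣ * u₀ * b + c * uᵣ * uⱼ * (1ℤ - u₀ * u₀)
      ring = solve-∀
      ring′ : ∀ a b → a + b * (1ℤ - 1ℤ) ≡ a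
      ring′ = solve-∀
    Z₂-column : ∀ i j → Z₂ i (suc j) ≡ Z₁ i (suc j)
    Z₂-column i j = trans (cong (_+_ (Z₁ i (suc j))) (∑-zero {f = λ s → C' (suc j) s * Z₁ i s} λ _ → refl))
                          (ℤP.+-identityʳ (Z₁ i (suc j)))
    Z₂-minor : ∀ r j → Z₂ (suc r) (suc j) ≡ y * δ r j
    Z₂-minor r j = begin
      Z₂ (suc r) (suc j)                                   ≡⟨ trans (Z₂-column (suc r) j) (Z₁-row r (suc j)) ⟩
      y * δ r j - u (suc r) * u₀ * (y * 0ℤ)                ≡⟨ ring (y * δ r j) (u (suc r) * u₀) y ⟩
      y * δ r j                                            ∎
      where
      ring : ∀ a b y → a - b * (y * 0ℤ) ≡ a
      ring = solve-∀
    Z₂-column₀ : ∀ r → Z₂ (suc r) zero ≡ 0ℤ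
    Z₂-column₀ r = begin
      Z₁ (suc r) zero + (0ℤ + sum (λ s → u (suc s) * u₀ * Z₁ (suc r) (suc s)))
        ≡⟨ cong₂ (λ a b → a + (0ℤ + b)) (Z₁-row r zero)
                 (sum-cong-≋ λ s → cong (u (suc s) * u₀ *_) (trans (sym (Z₂-column (suc r) s)) (Z₂-minor r s))) ⟩
      y * 0ℤ - u (suc r) * u₀ * (y * 1ℤ) + (0ℤ + sum (λ s → u (suc s) * u₀ * (y * δ r s)))
        ≡⟨ cong (λ b → y * 0ℤ - u (suc r) * u₀ * (y * 1ℤ) + (0ℤ + b))
                (trans (sum-cong-≋ λ s → ring (u (suc s) * u₀) y (δ r s)) (∑-δ r (λ s → u (suc s) * u₀ * y))) ⟩
      y * 0ℤ - u (suc r) * u₀ * (y * 1ℤ) + (0ℤ + u (suc r) * u₀ * y)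
        ≡⟨ ring′ y (u (suc r) * u₀) ⟩
      0ℤ
        ∎
      where
      ring : ∀ a y d → a * (y * d) ≡ d * (a * y)
      ring = solve-∀
      ring′ : ∀ y a → y * 0ℤ - a * (y * 1ℤ) + (0ℤ + a * y) ≡ 0ℤ
      ring′ = solve-∀
    Z₂-corner : Z₂ zero zero ≡ y + c * + suc m
    Z₂-corner = begin
      Z₁ zero zero + (0ℤ + sum (λ s → u (suc s) * u₀ * Z₁ zero (suc s)))
        ≡⟨ cong₂ (λ a b → a + (0ℤ + b)) (Z₁-row₀ zero)
                 (sum-cong-≋ λ s → trans (cong (u (suc s) * u₀ *_) (Z₁-row₀ (suc s))) (ring (u (suc s)) (u²≡1 (suc s)))) ⟩
      y * 1ℤ + c * (u₀ * u₀) + (0ℤ + sum {m} (λ _ → c))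
        ≡⟨ cong₂ (λ a b → y * 1ℤ + c * a + (0ℤ + b)) (u²≡1 zero) (∑-const c) ⟩
      y * 1ℤ + c * 1ℤ + (0ℤ + c * + m)
        ≡⟨ ring′ y c (+ m) ⟩
      y + c * + suc m
        ∎
      where
      ring : ∀ uₛ → uₛ * uₛ ≡ 1ℤ → uₛ * u₀ * (y * 0ℤ + c * (u₀ * uₛ)) ≡ c
      ring uₛ uₛ²≡1 = begin
        uₛ * u₀ * (y * 0ℤ + c * (u₀ * uₛ)) ≡⟨ rearrange y c uₛ u₀ ⟩
        c * (u₀ * u₀) * (uₛ * uₛ)           ≡⟨ cong₂ (λ a b → c * a * b) (u²≡1 zero) uₛ²≡1 ⟩
        c * 1ℤ * 1ℤ                         ≡⟨ trans (ℤP.*-identityʳ (c * 1ℤ)) (ℤP.*-identityʳ c) ⟩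
        c                                   ∎
        where
        rearrange : ∀ y c uₛ u₀ → uₛ * u₀ * (y * 0ℤ + c * (u₀ * uₛ)) ≡ c * (u₀ * u₀) * (uₛ * uₛ)
        rearrange = solve-∀
      ring′ : ∀ y c m → y * 1ℤ + c * 1ℤ + (0ℤ + c * m) ≡ y + c * (1ℤ + m)
      ring′ = solve-∀

  det-cast : ∀ {a b} (a≡b : a ≡ b) (A : Mat b) → det b A ≡ det a (λ i j → A (Fin.cast a≡b i) (Fin.cast a≡b j))
  det-cast {a} refl A = det-cong a λ i j → sym (cong₂ A (FinP.cast-is-id refl i) (FinP.cast-is-id refl j))

  det-block-symmetric-combine : ∀ n (Z : Mat (2 ℕ.* n)) (P Q : Mat n) →
    (∀ (ε : Fin 2) i j → Z (combine ε i) (combine ε j) ≡ P i j) →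
    (∀ (ε : Fin 2) i j → Z (combine ε i) (combine (Fin.opposite ε) j) ≡ Q i j) →
    det (2 ℕ.* n) Z ≡ det n (λ i j → P i j + Q i j) * det n (λ i j → P i j - Q i j)
  det-block-symmetric-combine n Z P Q diagonal offDiagonal =
    trans (det-cast n+n≡2n Z) (det-block-symmetric n _ P Q
      (λ i j → trans (cong₂ Z (cast-top i) (cast-top j)) (diagonal zero i j))
      (λ i j → trans (cong₂ Z (cast-top i) (cast-bot j)) (offDiagonal zero i j))
      (λ i j → trans (cong₂ Z (cast-bot i) (cast-top j)) (offDiagonal (suc zero) i j))
      (λ i j → trans (cong₂ Z (cast-bot i) (cast-bot j)) (diagonal (suc zero) i j)))
    where
    n+n≡2n : n ℕ.+ n ≡ 2 ℕ.* n
    n+n≡2n = cong (n ℕ.+_) (sym (ℕP.+-identityʳ n))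
    cast-top : ∀ i → Fin.cast n+n≡2n (i ↑ˡ n) ≡ combine {2} zero i
    cast-top i = FinP.toℕ-injective (begin
      toℕ (Fin.cast n+n≡2n (i ↑ˡ n)) ≡⟨ FinP.toℕ-cast n+n≡2n (i ↑ˡ n) ⟩
      toℕ (i ↑ˡ n)                   ≡⟨ FinP.toℕ-↑ˡ i n ⟩
      toℕ i                          ≡⟨ FinP.toℕ-↑ˡ i (n ℕ.+ 0) ⟨
      toℕ (combine {2} zero i)       ∎)
      where open ≡-Reasoning
    cast-bot : ∀ i → Fin.cast n+n≡2n (n ↑ʳ i) ≡ combine {2} (suc zero) i
    cast-bot i = FinP.toℕ-injective (begin
      toℕ (Fin.cast n+n≡2n (n ↑ʳ i)) ≡⟨ FinP.toℕ-cast n+n≡2n (n ↑ʳ i) ⟩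
      toℕ (n ↑ʳ i)                   ≡⟨ FinP.toℕ-↑ʳ n i ⟩
      n ℕ.+ toℕ i                    ≡⟨ cong (n ℕ.+_) (FinP.toℕ-↑ˡ i 0) ⟨
      n ℕ.+ toℕ (i ↑ˡ 0)             ≡⟨ FinP.toℕ-↑ʳ n (i ↑ˡ 0) ⟨
      toℕ (combine {2} (suc zero) i) ∎)
      where open ≡-Reasoning

  prodFin-cong : ∀ n {f g : Fin n → ℤ} → (∀ i → f i ≡ g i) → prodFin n f ≡ prodFin n g
  prodFin-cong zero    _   = refl
  prodFin-cong (suc n) f≗g = cong₂ _*_ (f≗g zero) (prodFin-cong n (f≗g ∘ suc))

  prodFin-↑ : ∀ m n (f : Fin (m ℕ.+ n) → ℤ) →
    prodFin (m ℕ.+ n) f ≡ prodFin m (λ i → f (i ↑ˡ n)) * prodFin n (λ j → f (m ↑ʳ j))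
  prodFin-↑ zero    n f = sym (ℤP.*-identityˡ _)
  prodFin-↑ (suc m) n f = trans (cong (f zero *_) (prodFin-↑ m n (f ∘ suc))) (sym (ℤP.*-assoc (f zero) _ _))

  prodFin-combine : ∀ n (f : Fin (2 ℕ.* n) → ℤ) →
    prodFin (2 ℕ.* n) f ≡ prodFin n (λ i → f (combine {2} zero i)) * prodFin n (λ i → f (combine {2} (suc zero) i))
  prodFin-combine n f = trans (prodFin-↑ n (n ℕ.+ 0) f)
    (cong (prodFin n (λ i → f (combine {2} zero i)) *_) (trans (prodFin-↑ n 0 (λ j → f (n ↑ʳ j))) (ℤP.*-identityʳ _)))

  prodFin-const : ∀ n (c : ℤ) → prodFin n (λ _ → c) ≡ c ^ n
  prodFin-const zero    c = refl
  prodFin-const (suc n) c = cong (c *_) (prodFin-const n c)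

open Determinant

%-absorbˡ : ∀ a b n .{{_ : NonZero n}} → (a % n ℕ.+ b) % n ≡ (a ℕ.+ b) % n
%-absorbˡ a b n = begin
  (a % n ℕ.+ b) % n              ≡⟨ %-distribˡ-+ (a % n) b n ⟩
  (a % n % n ℕ.+ b % n) % n      ≡⟨ cong (λ x → (x ℕ.+ b % n) % n) (m%n%n≡m%n a n) ⟩
  (a % n ℕ.+ b % n) % n          ≡⟨ %-distribˡ-+ a b n ⟨
  (a ℕ.+ b) % n                  ∎
  where open ≡-Reasoning

parity-% : ∀ a n .{{_ : NonZero n}} → parity n ≡ 0ℙ → parity (a % n) ≡ parity a
parity-% a n n-even = begin
  parity (a % n)                                        ≡⟨ ℙP.+-identityʳ (parity (a % n)) ⟨
  parity (a % n) ℙ.+ 0ℙ                                 ≡⟨ cong (parity (a % n) ℙ.+_) (ℙP.*-zeroʳ (parity (a / n))) ⟨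
  parity (a % n) ℙ.+ (parity (a / n) ℙ.* 0ℙ)            ≡⟨ cong (λ p → parity (a % n) ℙ.+ (parity (a / n) ℙ.* p)) n-even ⟨
  parity (a % n) ℙ.+ (parity (a / n) ℙ.* parity n)      ≡⟨ cong (parity (a % n) ℙ.+_) (ℙP.*-homo-* (a / n) n) ⟨
  parity (a % n) ℙ.+ parity (a / n ℕ.* n)               ≡⟨ ℙP.+-homo-+ (a % n) (a / n ℕ.* n) ⟨
  parity (a % n ℕ.+ a / n ℕ.* n)                        ≡⟨ cong parity (m≡m%n+[m/n]*n a n) ⟨
  parity a                                              ∎
  where open ≡-Reasoning

even⇒double : ∀ a → parity a ≡ 0ℙ → ∃ λ t → a ≡ 2 ℕ.* t
even⇒double zero          _      = 0 , refl
even⇒double (suc (suc a)) a-even with t , a≡2t ← even⇒double a a-even =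
  suc t , cong suc (trans (cong suc a≡2t) (sym (ℕP.+-suc t (t ℕ.+ 0))))

module Residues (n : ℕ) .{{_ : NonZero n}} where

  toℕ-mod : ∀ a → toℕ (a mod n) ≡ a % n
  toℕ-mod a = FinP.toℕ-fromℕ< (m%n<n a n)

  diff : Fin n → Fin n → Fin n
  diff x y = (toℕ x ℕ.+ (n ℕ.∸ toℕ y)) mod n

  diff≡⇔ : ∀ x y z → diff x y ≡ z ⇔ (toℕ z ℕ.+ toℕ y) % n ≡ toℕ x
  diff≡⇔ x y z = mk⇔ to from
    where
    open ≡-Reasoning
    y+[n∸y]≡n : toℕ y ℕ.+ (n ℕ.∸ toℕ y) ≡ n
    y+[n∸y]≡n = ℕP.m+[n∸m]≡n (ℕP.<⇒≤ (FinP.toℕ<n y))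
    to : diff x y ≡ z → (toℕ z ℕ.+ toℕ y) % n ≡ toℕ x
    to refl = begin
      (toℕ (diff x y) ℕ.+ toℕ y) % n                ≡⟨ cong (λ k → (k ℕ.+ toℕ y) % n) (toℕ-mod (toℕ x ℕ.+ (n ℕ.∸ toℕ y))) ⟩
      ((toℕ x ℕ.+ (n ℕ.∸ toℕ y)) % n ℕ.+ toℕ y) % n  ≡⟨ %-absorbˡ (toℕ x ℕ.+ (n ℕ.∸ toℕ y)) (toℕ y) n ⟩
      (toℕ x ℕ.+ (n ℕ.∸ toℕ y) ℕ.+ toℕ y) % n        ≡⟨ cong (_% n) (ℕP.+-assoc (toℕ x) _ (toℕ y)) ⟩
      (toℕ x ℕ.+ ((n ℕ.∸ toℕ y) ℕ.+ toℕ y)) % n      ≡⟨ cong (λ k → (toℕ x ℕ.+ k) % n) (trans (ℕP.+-comm _ (toℕ y)) y+[n∸y]≡n) ⟩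
      (toℕ x ℕ.+ n) % n                              ≡⟨ [m+n]%n≡m%n (toℕ x) n ⟩
      toℕ x % n                                      ≡⟨ m<n⇒m%n≡m (FinP.toℕ<n x) ⟩
      toℕ x                                          ∎
    from : (toℕ z ℕ.+ toℕ y) % n ≡ toℕ x → diff x y ≡ z
    from z+y≡x = FinP.toℕ-injective (begin
      toℕ (diff x y)                                 ≡⟨ toℕ-mod (toℕ x ℕ.+ (n ℕ.∸ toℕ y)) ⟩
      (toℕ x ℕ.+ (n ℕ.∸ toℕ y)) % n                  ≡⟨ cong (λ k → (k ℕ.+ (n ℕ.∸ toℕ y)) % n) z+y≡x ⟨
      ((toℕ z ℕ.+ toℕ y) % n ℕ.+ (n ℕ.∸ toℕ y)) % n  ≡⟨ %-absorbˡ (toℕ z ℕ.+ toℕ y) (n ℕ.∸ toℕ y) n ⟩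
      (toℕ z ℕ.+ toℕ y ℕ.+ (n ℕ.∸ toℕ y)) % n        ≡⟨ cong (_% n) (trans (ℕP.+-assoc (toℕ z) (toℕ y) _) (cong (toℕ z ℕ.+_) y+[n∸y]≡n)) ⟩
      (toℕ z ℕ.+ n) % n                              ≡⟨ [m+n]%n≡m%n (toℕ z) n ⟩
      toℕ z % n                                      ≡⟨ m<n⇒m%n≡m (FinP.toℕ<n z) ⟩
      toℕ z                                          ∎)

  parity-diff : parity n ≡ 0ℙ → ∀ x y → parity (toℕ (diff x y)) ≡ parity (toℕ x) ℙ.+ parity (toℕ y)
  parity-diff n-even x y = begin
    pz                       ≡⟨ ℙP.+-identityʳ pz ⟨
    pz ℙ.+ 0ℙ                ≡⟨ cong (pz ℙ.+_) (ℙP.p+p≡0ℙ py) ⟨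
    pz ℙ.+ (py ℙ.+ py)       ≡⟨ ℙP.+-assoc pz py py ⟨
    pz ℙ.+ py ℙ.+ py         ≡⟨ cong (ℙ._+ py) (trans (sym (ℙP.+-homo-+ (toℕ z) (toℕ y))) (sym (parity-% _ n n-even))) ⟩
    parity ((toℕ z ℕ.+ toℕ y) % n) ℙ.+ py ≡⟨ cong (λ k → parity k ℙ.+ py) (Equivalence.to (diff≡⇔ x y z) refl) ⟩
    parity (toℕ x) ℙ.+ py    ∎
    where
    open ≡-Reasoning
    z = diff x y
    pz = parity (toℕ z)
    py = parity (toℕ y)

  diff-swap : ∀ x y z → diff x y ≡ z → diff x z ≡ y
  diff-swap x y z xy≡z = Equivalence.from (diff≡⇔ x z y)
    (trans (cong (_% n) (ℕP.+-comm (toℕ y) (toℕ z))) (Equivalence.to (diff≡⇔ x y z) xy≡z))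

module ParityIndicators where

  open import Data.Integer using (_+_; _-_; _*_; -_)

  evenIndicator : Parity → ℤ
  evenIndicator 0ℙ = 1ℤ
  evenIndicator 1ℙ = 0ℤ

  sameParity : ∀ {n} → Fin n → Fin n → ℤ
  sameParity i j = evenIndicator (parity (toℕ i) ℙ.+ parity (toℕ j))

  paritySign : Parity → ℤ
  paritySign 0ℙ = 1ℤ
  paritySign 1ℙ = -1ℤ

  sign≡paritySign : ∀ k → sign k ≡ paritySign (parity k)
  sign≡paritySign zero          = refl
  sign≡paritySign (suc zero)    = refl
  sign≡paritySign (suc (suc k)) = sign≡paritySign k

  sign-*-sign : ∀ k l → sign k * sign l ≡ + 2 * evenIndicator (parity k ℙ.+ parity l) - 1ℤ
  sign-*-sign k l rewrite sign≡paritySign k | sign≡paritySign l = by-parity (parity k) (parity l)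
    where
    by-parity : ∀ p q → paritySign p * paritySign q ≡ + 2 * evenIndicator (p ℙ.+ q) - 1ℤ
    by-parity 0ℙ 0ℙ = refl
    by-parity 0ℙ 1ℙ = refl
    by-parity 1ℙ 0ℙ = refl
    by-parity 1ℙ 1ℙ = refl

  sign-*-sign-self : ∀ k → sign k * sign k ≡ 1ℤ
  sign-*-sign-self k rewrite sign≡paritySign k with parity k
  ... | 0ℙ = refl
  ... | 1ℙ = refl

  evenIndicator-cancel : ∀ p q r → evenIndicator ((p ℙ.+ q) ℙ.+ (p ℙ.+ r)) ≡ evenIndicator (q ℙ.+ r)
  evenIndicator-cancel p q r = cong evenIndicator (begin
    (p ℙ.+ q) ℙ.+ (p ℙ.+ r) ≡⟨ cong (ℙ._+ (p ℙ.+ r)) (ℙP.+-comm p q) ⟩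
    (q ℙ.+ p) ℙ.+ (p ℙ.+ r) ≡⟨ ℙP.+-assoc q p (p ℙ.+ r) ⟩
    q ℙ.+ (p ℙ.+ (p ℙ.+ r)) ≡⟨ cong (q ℙ.+_) (ℙP.+-assoc p p r) ⟨
    q ℙ.+ (p ℙ.+ p ℙ.+ r)   ≡⟨ cong (λ s → q ℙ.+ (s ℙ.+ r)) (ℙP.p+p≡0ℙ p) ⟩
    q ℙ.+ r                 ∎)
    where open ≡-Reasoning

  evenIndicator-opposite : ∀ p q r → evenIndicator ((p ℙ.+ q) ℙ.+ (p ℙ.⁻¹ ℙ.+ r)) ≡ 1ℤ - evenIndicator (q ℙ.+ r)
  evenIndicator-opposite 0ℙ 0ℙ 0ℙ = refl
  evenIndicator-opposite 0ℙ 0ℙ 1ℙ = refl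
  evenIndicator-opposite 0ℙ 1ℙ 0ℙ = refl
  evenIndicator-opposite 0ℙ 1ℙ 1ℙ = refl
  evenIndicator-opposite 1ℙ 0ℙ 0ℙ = refl
  evenIndicator-opposite 1ℙ 0ℙ 1ℙ = refl
  evenIndicator-opposite 1ℙ 1ℙ 0ℙ = refl
  evenIndicator-opposite 1ℙ 1ℙ 1ℙ = refl

open ParityIndicators

module DihedralAdjacency (m : ℕ) .{{_ : NonZero m}} where
  open Dihedral m
  open FinGroupOps D
  open Residues n
  open import Data.Integer using (_+_; _-_; _*_; -_)

  n-even : parity n ≡ 0ℙ
  n-even = ℙP.*-homo-* 2 m

  m<n : m ℕ.< n
  m<n = ℕP.m<m+n m (ℕP.<-≤-trans (ℕ.>-nonZero⁻¹ m) (ℕP.m≤m+n m 0))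

  mₙ 0ₙ : Fin n
  mₙ = m mod n
  0ₙ = 0 mod n

  toℕ-mₙ : toℕ mₙ ≡ m
  toℕ-mₙ = trans (toℕ-mod m) (m<n⇒m%n≡m m<n)

  toℕ-0ₙ : toℕ 0ₙ ≡ 0
  toℕ-0ₙ = trans (toℕ-mod 0) (m<n⇒m%n≡m (ℕP.≤-<-trans ℕ.z≤n m<n))

  double : Fin m → Fin n
  double t = (2 ℕ.* toℕ t) mod n

  toℕ-double : ∀ t → toℕ (double t) ≡ 2 ℕ.* toℕ t
  toℕ-double t = trans (toℕ-mod (2 ℕ.* toℕ t)) (m<n⇒m%n≡m (ℕP.*-monoʳ-< 2 (FinP.toℕ<n t)))

  partner : Fin n → Fin n
  partner i = (m ℕ.+ toℕ i) mod n

  partner-involutive : ∀ i → partner (partner i) ≡ i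
  partner-involutive i = FinP.toℕ-injective (begin
    toℕ (partner (partner i))               ≡⟨ toℕ-mod (m ℕ.+ toℕ (partner i)) ⟩
    (m ℕ.+ toℕ (partner i)) % n             ≡⟨ cong (λ k → (m ℕ.+ k) % n) (toℕ-mod (m ℕ.+ toℕ i)) ⟩
    (m ℕ.+ (m ℕ.+ toℕ i) % n) % n           ≡⟨ cong (_% n) (ℕP.+-comm m _) ⟩
    ((m ℕ.+ toℕ i) % n ℕ.+ m) % n           ≡⟨ %-absorbˡ (m ℕ.+ toℕ i) m n ⟩
    (m ℕ.+ toℕ i ℕ.+ m) % n                 ≡⟨ cong (_% n) (ring m (toℕ i)) ⟩
    (toℕ i ℕ.+ n) % n                       ≡⟨ [m+n]%n≡m%n (toℕ i) n ⟩
    toℕ i % n                               ≡⟨ m<n⇒m%n≡m (FinP.toℕ<n i) ⟩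
    toℕ i                                   ∎)
    where
    open ≡-Reasoning
    ring : ∀ m i → m ℕ.+ i ℕ.+ m ≡ i ℕ.+ (m ℕ.+ (m ℕ.+ 0))
    ring = ℕ-Solver.solve-∀

  δ-diff-mₙ : ∀ x y → δ (diff x y) mₙ ≡ δ x (partner y)
  δ-diff-mₙ x y = δ-cong-⇔ (mk⇔
    (λ xy≡m → sym (FinP.toℕ-injective (trans (toℕ-mod _) (subst (λ k → (k ℕ.+ toℕ y) % n ≡ toℕ x) toℕ-mₙ
                                                         (Equivalence.to (diff≡⇔ x y mₙ) xy≡m)))))
    (λ x≡py → Equivalence.from (diff≡⇔ x y mₙ)
                 (trans (cong (λ k → (k ℕ.+ toℕ y) % n) toℕ-mₙ) (trans (sym (toℕ-mod _)) (cong toℕ (sym x≡py))))))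

  δ-partner-sym : ∀ i j → δ j (partner i) ≡ δ i (partner j)
  δ-partner-sym i j = δ-cong-⇔ (mk⇔
    (λ j≡pi → trans (sym (partner-involutive i)) (cong partner (sym j≡pi)))
    (λ i≡pj → trans (sym (partner-involutive j)) (cong partner (sym i≡pj))))

  -- The reflections b a^(2t) = a^(−2t) b of S₂ have residues −2t (mod 2m), which run once
  -- through the even residues.
  even-residues : ∀ ρ → sum {m} (λ t → δ ρ (diff 0ₙ (double t))) ≡ evenIndicator (parity (toℕ ρ))
  even-residues ρ = trans (sum-cong-≋ λ t → δ-cong-⇔ (mk⇔ (λ eq → sym (diff-swap 0ₙ (double t) ρ (sym eq)))
                                                                  (λ eq → sym (diff-swap 0ₙ ρ (double t) (sym eq)))))
                          (by-parity (parity (toℕ ρ)) refl)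
    where
    ρ̄ = diff 0ₙ ρ
    parity-ρ̄ : parity (toℕ ρ̄) ≡ parity (toℕ ρ)
    parity-ρ̄ = trans (parity-diff n-even 0ₙ ρ) (cong (λ k → parity k ℙ.+ parity (toℕ ρ)) toℕ-0ₙ)
    by-parity : ∀ p → parity (toℕ ρ) ≡ p → sum {m} (λ t → δ (double t) ρ̄) ≡ evenIndicator p
    by-parity 0ℙ ρ-even with t₀ , ρ̄≡2t₀ ← even⇒double (toℕ ρ̄) (trans parity-ρ̄ ρ-even) = begin
      sum {m} (λ t → δ (double t) ρ̄)   ≡⟨ sum-cong-≋ (λ t → δ-cong-⇔ (mk⇔ (double≡ρ̄⇒ {t}) (⇒double≡ρ̄ {t}))) ⟩
      sum {m} (λ t → δ t T)            ≡⟨ sum-cong-≋ (λ t → trans (δ-sym t T) (sym (ℤP.*-identityʳ (δ T t)))) ⟩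
      sum {m} (λ t → δ T t * 1ℤ)       ≡⟨ ∑-δ T (λ _ → 1ℤ) ⟩
      1ℤ                           ∎
      where
      open ≡-Reasoning
      t₀<m : t₀ ℕ.< m
      t₀<m = ℕP.*-cancelˡ-< 2 t₀ m (subst (ℕ._< n) ρ̄≡2t₀ (FinP.toℕ<n ρ̄))
      T : Fin m
      T = Fin.fromℕ< t₀<m
      double≡ρ̄⇒ : ∀ {t} → double t ≡ ρ̄ → t ≡ T
      double≡ρ̄⇒ {t} eq = FinP.toℕ-injective (trans (ℕP.*-cancelˡ-≡ (toℕ t) t₀ 2
        (trans (sym (toℕ-double t)) (trans (cong toℕ eq) ρ̄≡2t₀))) (sym (FinP.toℕ-fromℕ< t₀<m)))
      ⇒double≡ρ̄ : ∀ {t} → t ≡ T → double t ≡ ρ̄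
      ⇒double≡ρ̄ refl = FinP.toℕ-injective (trans (toℕ-double T)
        (trans (cong (2 ℕ.*_) (FinP.toℕ-fromℕ< t₀<m)) (sym ρ̄≡2t₀)))
    by-parity 1ℙ ρ-odd = ∑-zero {f = λ t → δ (double t) ρ̄} λ t → δ-≢ {i = double t} {ρ̄} λ double≡ρ̄ →
      ℙP.p≢p⁻¹ 0ℙ (begin
      0ℙ                           ≡⟨ ℙP.*-homo-* 2 (toℕ t) ⟨
      parity (2 ℕ.* toℕ t)         ≡⟨ cong parity (toℕ-double t) ⟨
      parity (toℕ (double t))      ≡⟨ cong (parity ∘ toℕ) double≡ρ̄ ⟩
      parity (toℕ ρ̄)               ≡⟨ trans parity-ρ̄ ρ-odd ⟩
      1ℙ                           ∎)
      where open ≡-Reasoning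

  dec-enc : ∀ (p : Elem) → dec (enc p) ≡ p
  dec-enc (ε , i) = FinP.remQuot-combine ε i

  inv-· : ∀ (p q : Elem) → inv (enc p) · enc q ≡ enc (mulE (invE p) q)
  inv-· p q rewrite dec-enc p | dec-enc (invE p) | dec-enc q = refl

  b·a^ : ∀ t → b · a^ t ≡ combine {2} (suc zero) (diff 0ₙ (t mod n))
  b·a^ t rewrite dec-enc (suc zero , 0ₙ) | dec-enc (zero , t mod n) = refl

  count-allFin : ∀ {M} g (f : Fin M → Fin (2 ℕ.* n)) → count D S g (List.map f (List.allFin M)) ≡ sum (λ t → δ g (f t))
  count-allFin {M} g f = trans (cong (count D S g) (map-tabulate id f)) (go f)
    where
    go : ∀ {M} (f : Fin M → Fin (2 ℕ.* n)) → count D S g (List.tabulate f) ≡ sum (λ t → δ g (f t))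
    go {zero}  f = refl
    go {suc M} f = cong₂ _+_ (δ-isYes g (f zero)) (go (f ∘ suc))

  count-S : ∀ (ε : Fin 2) (ρ : Fin n) →
    count D S (combine ε ρ) S ≡ δ ε zero * δ ρ mₙ + δ ε (suc zero) * evenIndicator (parity (toℕ ρ))
  count-S ε ρ = cong₂ _+_ (trans (δ-isYes (combine ε ρ) (a^ m)) (δ-combine ε zero ρ mₙ)) (begin
    count D S (combine ε ρ) S₂
      ≡⟨ count-allFin {m} (combine ε ρ) (λ t → b · a^ (2 ℕ.* toℕ t)) ⟩
    sum {m} (λ t → δ (combine ε ρ) (b · a^ (2 ℕ.* toℕ t)))
      ≡⟨ sum-cong-≋ (λ t → trans (cong (δ (combine ε ρ)) (b·a^ (2 ℕ.* toℕ t)))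
                                 (δ-combine ε (suc zero) ρ (diff 0ₙ (double t)))) ⟩
    sum {m} (λ t → δ ε (suc zero) * δ ρ (diff 0ₙ (double t)))
      ≡⟨ *-distribˡ-sum (δ ε (suc zero)) (λ t → δ ρ (diff 0ₙ (double t))) ⟨
    δ ε (suc zero) * sum {m} (λ t → δ ρ (diff 0ₙ (double t)))
      ≡⟨ cong (δ ε (suc zero) *_) (even-residues ρ) ⟩
    δ ε (suc zero) * evenIndicator (parity (toℕ ρ))
      ∎)
    where open ≡-Reasoning

  negate-then-add : ∀ i j → (toℕ ((n ℕ.∸ toℕ i) mod n) ℕ.+ toℕ j) mod n ≡ diff j i
  negate-then-add i j = FinP.toℕ-injective (begin
    toℕ ((toℕ ((n ℕ.∸ toℕ i) mod n) ℕ.+ toℕ j) mod n) ≡⟨ toℕ-mod _ ⟩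
    (toℕ ((n ℕ.∸ toℕ i) mod n) ℕ.+ toℕ j) % n         ≡⟨ cong (λ k → (k ℕ.+ toℕ j) % n) (toℕ-mod (n ℕ.∸ toℕ i)) ⟩
    ((n ℕ.∸ toℕ i) % n ℕ.+ toℕ j) % n                 ≡⟨ %-absorbˡ (n ℕ.∸ toℕ i) (toℕ j) n ⟩
    ((n ℕ.∸ toℕ i) ℕ.+ toℕ j) % n                     ≡⟨ cong (_% n) (ℕP.+-comm (n ℕ.∸ toℕ i) (toℕ j)) ⟩
    (toℕ j ℕ.+ (n ℕ.∸ toℕ i)) % n                     ≡⟨ toℕ-mod _ ⟨
    toℕ (diff j i)                                    ∎)
    where open ≡-Reasoning

  count-S-rotation : ∀ ρ → count D S (combine {2} zero ρ) S ≡ δ ρ mₙ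
  count-S-rotation ρ = trans (count-S zero ρ) (trans (ℤP.+-identityʳ (1ℤ * δ ρ mₙ)) (ℤP.*-identityˡ (δ ρ mₙ)))

  count-S-reflection : ∀ ρ → count D S (combine {2} (suc zero) ρ) S ≡ evenIndicator (parity (toℕ ρ))
  count-S-reflection ρ = trans (count-S (suc zero) ρ) (trans (ℤP.+-identityˡ _) (ℤP.*-identityˡ _))

  adj : Mat (2 ℕ.* n)
  adj = adjMatrix D S

  adj-same : ∀ (ε : Fin 2) i j → adj (combine ε i) (combine ε j) ≡ δ i (partner j)
  adj-same zero i j = begin
    count D S (inv (enc (zero , i)) · enc (zero , j)) S ≡⟨ cong (λ g → count D S g S) (inv-· (zero , i) (zero , j)) ⟩
    count D S (combine {2} zero r) S                    ≡⟨ count-S-rotation r ⟩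
    δ r mₙ                                              ≡⟨ cong (λ r → δ r mₙ) (negate-then-add i j) ⟩
    δ (diff j i) mₙ                                     ≡⟨ δ-diff-mₙ j i ⟩
    δ j (partner i)                                     ≡⟨ δ-partner-sym i j ⟩
    δ i (partner j)                                     ∎
    where
    open ≡-Reasoning
    r = (toℕ ((n ℕ.∸ toℕ i) mod n) ℕ.+ toℕ j) mod n
  adj-same (suc zero) i j = begin
    count D S (inv (enc (suc zero , i)) · enc (suc zero , j)) S
      ≡⟨ cong (λ g → count D S g S) (inv-· (suc zero , i) (suc zero , j)) ⟩
    count D S (combine {2} zero (diff i j)) S                       ≡⟨ count-S-rotation (diff i j) ⟩
    δ (diff i j) mₙ                                             ≡⟨ δ-diff-mₙ i j ⟩
    δ i (partner j)                                             ∎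
    where open ≡-Reasoning

  adj-cross : ∀ (ε : Fin 2) (i j : Fin n) →
    adj (combine ε i) (combine (Fin.opposite ε) j) ≡ sameParity i j
  adj-cross zero i j = begin
    count D S (inv (enc (zero , i)) · enc (suc zero , j)) S ≡⟨ cong (λ g → count D S g S) (inv-· (zero , i) (suc zero , j)) ⟩
    count D S (combine {2} (suc zero) r) S                  ≡⟨ count-S-reflection r ⟩
    evenIndicator (parity (toℕ r))                          ≡⟨ cong (evenIndicator ∘ parity ∘ toℕ) (negate-then-add i j) ⟩
    evenIndicator (parity (toℕ (diff j i)))                 ≡⟨ cong evenIndicator (trans (parity-diff n-even j i) (ℙP.+-comm (parity (toℕ j)) _)) ⟩
    sameParity i j                                          ∎
    where
    open ≡-Reasoning
    r = (toℕ ((n ℕ.∸ toℕ i) mod n) ℕ.+ toℕ j) mod n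
  adj-cross (suc zero) i j = begin
    count D S (inv (enc (suc zero , i)) · enc (zero , j)) S ≡⟨ cong (λ g → count D S g S) (inv-· (suc zero , i) (zero , j)) ⟩
    count D S (combine {2} (suc zero) (diff i j)) S         ≡⟨ count-S-reflection (diff i j) ⟩
    evenIndicator (parity (toℕ (diff i j)))                 ≡⟨ cong evenIndicator (parity-diff n-even i j) ⟩
    sameParity i j                                          ∎
    where open ≡-Reasoning

module OddDihedral (k : ℕ) where

  m : ℕ
  m = suc (2 ℕ.* k)

  open Dihedral m using (n; D; S)
  open DihedralAdjacency m
  open Residues n using (toℕ-mod)
  open import Data.Integer using (_+_; _-_; _*_; -_; _^_)

  m-odd : parity m ≡ 1ℙ
  m-odd = trans (ℙP.+-homo-+ 1 (2 ℕ.* k)) (cong (1ℙ ℙ.+_) (ℙP.*-homo-* 2 k))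

  parity-combine : ∀ (h : Fin 2) (a : Fin m) → parity (toℕ (combine h a)) ≡ parity (toℕ h) ℙ.+ parity (toℕ a)
  parity-combine h a = begin
    parity (toℕ (combine h a))                     ≡⟨ cong parity (FinP.toℕ-combine h a) ⟩
    parity (m ℕ.* toℕ h ℕ.+ toℕ a)                 ≡⟨ ℙP.+-homo-+ (m ℕ.* toℕ h) (toℕ a) ⟩
    parity (m ℕ.* toℕ h) ℙ.+ parity (toℕ a)        ≡⟨ cong (ℙ._+ parity (toℕ a)) (ℙP.*-homo-* m (toℕ h)) ⟩
    parity m ℙ.* parity (toℕ h) ℙ.+ parity (toℕ a) ≡⟨ cong (λ p → p ℙ.* parity (toℕ h) ℙ.+ parity (toℕ a)) m-odd ⟩
    parity (toℕ h) ℙ.+ parity (toℕ a)              ∎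
    where open ≡-Reasoning

  parity-opposite : ∀ (h : Fin 2) → parity (toℕ (Fin.opposite h)) ≡ parity (toℕ h) ℙ.⁻¹
  parity-opposite zero       = refl
  parity-opposite (suc zero) = refl

  partner-combine : ∀ (h : Fin 2) (a : Fin m) → partner (combine h a) ≡ combine (Fin.opposite h) a
  partner-combine zero a = FinP.toℕ-injective (begin
    toℕ (partner (combine {2} zero a))  ≡⟨ toℕ-mod (m ℕ.+ toℕ (combine {2} zero a)) ⟩
    (m ℕ.+ toℕ (a ↑ˡ (m ℕ.+ 0))) % n    ≡⟨ cong (λ t → (m ℕ.+ t) % n) (FinP.toℕ-↑ˡ a (m ℕ.+ 0)) ⟩
    (m ℕ.+ toℕ a) % n                   ≡⟨ m<n⇒m%n≡m (ℕP.+-monoʳ-< m (ℕP.<-≤-trans (FinP.toℕ<n a) (ℕP.m≤m+n m 0))) ⟩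
    m ℕ.+ toℕ a                         ≡⟨ cong (m ℕ.+_) (FinP.toℕ-↑ˡ a 0) ⟨
    m ℕ.+ toℕ (a ↑ˡ 0)                  ≡⟨ FinP.toℕ-↑ʳ m (a ↑ˡ 0) ⟨
    toℕ (combine {2} (suc zero) a)      ∎)
    where open ≡-Reasoning
  partner-combine (suc zero) a = FinP.toℕ-injective (begin
    toℕ (partner (combine {2} (suc zero) a)) ≡⟨ toℕ-mod (m ℕ.+ toℕ (combine {2} (suc zero) a)) ⟩
    (m ℕ.+ toℕ (m ↑ʳ (a ↑ˡ 0))) % n          ≡⟨ cong (λ t → (m ℕ.+ t) % n)
                                                     (trans (FinP.toℕ-↑ʳ m (a ↑ˡ 0)) (cong (m ℕ.+_) (FinP.toℕ-↑ˡ a 0))) ⟩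
    (m ℕ.+ (m ℕ.+ toℕ a)) % n                ≡⟨ cong (_% n) (ring m (toℕ a)) ⟩
    (toℕ a ℕ.+ n) % n                        ≡⟨ [m+n]%n≡m%n (toℕ a) n ⟩
    toℕ a % n                                ≡⟨ m<n⇒m%n≡m (ℕP.<-trans (FinP.toℕ<n a) m<n) ⟩
    toℕ a                                    ≡⟨ FinP.toℕ-↑ˡ a (m ℕ.+ 0) ⟨
    toℕ (combine {2} zero a)                 ∎)
    where
    open ≡-Reasoning
    ring : ∀ m a → m ℕ.+ (m ℕ.+ a) ≡ a ℕ.+ (m ℕ.+ (m ℕ.+ 0))
    ring = ℕ-Solver.solve-∀

  δ-combine-opposite : ∀ (h : Fin 2) {l} (a b : Fin l) → δ (combine h a) (combine (Fin.opposite h) b) ≡ 0ℤ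
  δ-combine-opposite h a b = trans (δ-combine h (Fin.opposite h) a b) (cong (_* δ a b) (δ-opposite h))
    where
    δ-opposite : ∀ (h : Fin 2) → δ h (Fin.opposite h) ≡ 0ℤ
    δ-opposite zero       = refl
    δ-opposite (suc zero) = refl

  δ-partner-same : ∀ (h : Fin 2) a b → δ (combine h a) (partner (combine h b)) ≡ 0ℤ
  δ-partner-same h a b = trans (cong (δ (combine h a)) (partner-combine h b)) (δ-combine-opposite h a b)

  δ-partner-opposite : ∀ (h : Fin 2) a b → δ (combine h a) (partner (combine (Fin.opposite h) b)) ≡ δ a b
  δ-partner-opposite h a b = begin
    δ (combine h a) (partner (combine (Fin.opposite h) b))        ≡⟨ cong (δ (combine h a)) (partner-combine (Fin.opposite h) b) ⟩
    δ (combine h a) (combine (Fin.opposite (Fin.opposite h)) b)   ≡⟨ cong (λ g → δ (combine h a) (combine g b)) (FinP.opposite-involutive h) ⟩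
    δ (combine h a) (combine h b)                                 ≡⟨ δ-combine-same h a b ⟩
    δ a b                                                         ∎
    where open ≡-Reasoning

  sameParity-same : ∀ (h : Fin 2) a b → sameParity (combine h a) (combine h b) ≡ sameParity a b
  sameParity-same h a b = trans (cong₂ (λ p q → evenIndicator (p ℙ.+ q)) (parity-combine h a) (parity-combine h b))
                       (evenIndicator-cancel (parity (toℕ h)) (parity (toℕ a)) (parity (toℕ b)))

  sameParity-opposite : ∀ (h : Fin 2) a b → sameParity (combine h a) (combine (Fin.opposite h) b) ≡ 1ℤ - sameParity a b
  sameParity-opposite h a b = begin
    sameParity (combine h a) (combine (Fin.opposite h) b)
      ≡⟨ cong₂ (λ p q → evenIndicator (p ℙ.+ q)) (parity-combine h a)
               (trans (parity-combine (Fin.opposite h) b) (cong (ℙ._+ parity (toℕ b)) (parity-opposite h))) ⟩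
    evenIndicator ((parity (toℕ h) ℙ.+ parity (toℕ a)) ℙ.+ (parity (toℕ h) ℙ.⁻¹ ℙ.+ parity (toℕ b)))
      ≡⟨ evenIndicator-opposite (parity (toℕ h)) (parity (toℕ a)) (parity (toℕ b)) ⟩
    1ℤ - sameParity a b
      ∎
    where open ≡-Reasoning

  -- The diagonal block of xI − A plus s times its off-diagonal block.
  charBlock : ℤ → ℤ → Mat n
  charBlock x s i j = x * δ i j - δ i (partner j) - s * sameParity i j

  charBlock-same : ∀ x s (h : Fin 2) a b → charBlock x s (combine h a) (combine h b) ≡ x * δ a b - s * sameParity a b
  charBlock-same x s h a b = begin
    x * δ (combine h a) (combine h b) - δ (combine h a) (partner (combine h b)) - s * sameParity (combine h a) (combine h b)
      ≡⟨ cong₂ (λ d d' → x * d - d' - s * sameParity (combine h a) (combine h b)) (δ-combine-same h a b) (δ-partner-same h a b) ⟩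
    x * δ a b - 0ℤ - s * sameParity (combine h a) (combine h b)
      ≡⟨ cong₂ (λ y ε → y - s * ε) (ℤP.+-identityʳ (x * δ a b)) (sameParity-same h a b) ⟩
    x * δ a b - s * sameParity a b
      ∎
    where open ≡-Reasoning

  charBlock-opposite : ∀ x s (h : Fin 2) a b →
    charBlock x s (combine h a) (combine (Fin.opposite h) b) ≡ - δ a b - s * (1ℤ - sameParity a b)
  charBlock-opposite x s h a b = begin
    x * δ (combine h a) (combine h′ b) - δ (combine h a) (partner (combine h′ b)) - s * sameParity (combine h a) (combine h′ b)
      ≡⟨ cong₃′ (δ-combine-opposite h a b) (δ-partner-opposite h a b) (sameParity-opposite h a b) ⟩
    x * 0ℤ - δ a b - s * (1ℤ - sameParity a b)
      ≡⟨ ring x (δ a b) s (sameParity a b) ⟩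
    - δ a b - s * (1ℤ - sameParity a b)
      ∎
    where
    open ≡-Reasoning
    h′ = Fin.opposite h
    cong₃′ : ∀ {d d' d″ ε ε' ε″} → d ≡ d' → ε ≡ ε' → d″ ≡ ε″ →
             x * d - ε - s * d″ ≡ x * d' - ε' - s * ε″
    cong₃′ refl refl refl = refl
    ring : ∀ x d s e → x * 0ℤ - d - s * (1ℤ - e) ≡ - d - s * (1ℤ - e)
    ring = solve-∀

  factor : ℤ → ℤ → ℤ → ℤ
  factor x s t = (x - t) ^ (2 ℕ.* k) * ((x - t) + - s * + m)

  det-charBlock : ∀ x s → det n (charBlock x s) ≡ factor x s 1ℤ * factor x s -1ℤ
  det-charBlock x s = begin
    det n (charBlock x s)
      ≡⟨ det-block-symmetric-combine m (charBlock x s) R T (charBlock-same x s) (charBlock-opposite x s) ⟩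
    det m (λ a b → R a b + T a b) * det m (λ a b → R a b - T a b)
      ≡⟨ cong₂ _*_ (trans (det-cong m λ a b → ring₁ x s (δ a b) (sameParity a b))
                          (det-scalar-plus-rank-one (2 ℕ.* k) (x - 1ℤ) (- s) (λ _ → 1ℤ) (λ _ → refl)))
                   (trans (det-cong m λ a b → trans (ring₂ x s (δ a b) (sameParity a b))
                                                    (cong (λ u → (x + 1ℤ) * δ a b + - s * u) (sym (sign-*-sign (toℕ a) (toℕ b)))))
                          (det-scalar-plus-rank-one (2 ℕ.* k) (x + 1ℤ) (- s) (sign ∘ toℕ) (sign-*-sign-self ∘ toℕ))) ⟩
    factor x s 1ℤ * factor x s -1ℤ
      ∎
    where
    open ≡-Reasoning
    R T : Mat m
    R a b = x * δ a b - s * sameParity a b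
    T a b = - δ a b - s * (1ℤ - sameParity a b)
    ring₁ : ∀ x s d e → x * d - s * e + (- d - s * (1ℤ - e)) ≡ (x - 1ℤ) * d + - s * (1ℤ * 1ℤ)
    ring₁ = solve-∀
    ring₂ : ∀ x s d e → x * d - s * e - (- d - s * (1ℤ - e)) ≡ (x + 1ℤ) * d + - s * (+ 2 * e - 1ℤ)
    ring₂ = solve-∀

  charMatrix-same : ∀ x (ε : Fin 2) i j →
    (if ⌊ combine ε i ≟ combine ε j ⌋ then x else 0ℤ) - adj (combine ε i) (combine ε j) ≡ x * δ i j - δ i (partner j)
  charMatrix-same x ε i j = cong₂ _-_
    (trans (if-≟ x (combine ε i) (combine ε j)) (cong (x *_) (δ-combine-same ε i j)))
    (adj-same ε i j)

  charMatrix-opposite : ∀ x (ε : Fin 2) i j →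
    (if ⌊ combine ε i ≟ combine (Fin.opposite ε) j ⌋ then x else 0ℤ) - adj (combine ε i) (combine (Fin.opposite ε) j)
      ≡ - sameParity i j
  charMatrix-opposite x ε i j = begin
    (if ⌊ combine ε i ≟ combine (Fin.opposite ε) j ⌋ then x else 0ℤ) - adj (combine ε i) (combine (Fin.opposite ε) j)
      ≡⟨ cong₂ _-_ (trans (if-≟ x (combine ε i) (combine (Fin.opposite ε) j)) (cong (x *_) (δ-combine-opposite ε i j)))
                   (adj-cross ε i j) ⟩
    x * 0ℤ - sameParity i j
      ≡⟨ cong (_- sameParity i j) (ℤP.*-zeroʳ x) ⟩
    0ℤ - sameParity i j
      ≡⟨ ℤP.+-identityˡ (- sameParity i j) ⟩
    - sameParity i j
      ∎
    where open ≡-Reasoning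

  factors : ℤ → ℤ
  factors x = (factor x 1ℤ 1ℤ * factor x 1ℤ -1ℤ) * (factor x -1ℤ 1ℤ * factor x -1ℤ -1ℤ)

  charPoly : ∀ x → charPolyAt (2 ℕ.* n) adj x ≡ factors x
  charPoly x = begin
    charPolyAt (2 ℕ.* n) adj x
      ≡⟨ det-block-symmetric-combine n (λ p q → (if ⌊ p ≟ q ⌋ then x else 0ℤ) - adj p q)
           (λ i j → x * δ i j - δ i (partner j)) (λ i j → - sameParity i j)
           (charMatrix-same x) (charMatrix-opposite x) ⟩
    det n (λ i j → x * δ i j - δ i (partner j) + - sameParity i j) * det n (λ i j → x * δ i j - δ i (partner j) - - sameParity i j)
      ≡⟨ cong₂ _*_ (det-cong n λ i j → ring₁ (x * δ i j - δ i (partner j)) (sameParity i j))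
                   (det-cong n λ i j → ring₂ (x * δ i j - δ i (partner j)) (sameParity i j)) ⟩
    det n (charBlock x 1ℤ) * det n (charBlock x -1ℤ)
      ≡⟨ cong₂ _*_ (det-charBlock x 1ℤ) (det-charBlock x -1ℤ) ⟩
    (factor x 1ℤ 1ℤ * factor x 1ℤ -1ℤ) * (factor x -1ℤ 1ℤ * factor x -1ℤ -1ℤ)
      ∎
    where
    open ≡-Reasoning
    ring₁ : ∀ a e → a + - e ≡ a - 1ℤ * e
    ring₁ = solve-∀
    ring₂ : ∀ a e → a - - e ≡ a - -1ℤ * e
    ring₂ = solve-∀

  eigenvalue : Fin 2 → Fin 2 → Fin m → ℤ
  eigenvalue ε h zero    = sign (toℕ h) + sign (toℕ ε) * + m
  eigenvalue ε h (suc _) = sign (toℕ h)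

  eigenvalues : Fin (2 ℕ.* n) → ℤ
  eigenvalues p = eigenvalueAt (remQuot n p)
    where
    eigenvalueAt : Fin 2 × Fin n → ℤ
    eigenvalueAt (ε , i) = uncurry (eigenvalue ε) (remQuot m i)

  eigenvalues-combine : ∀ (ε h : Fin 2) a → eigenvalues (combine ε (combine h a)) ≡ eigenvalue ε h a
  eigenvalues-combine ε h a = trans (cong (λ (q : Fin 2 × Fin n) → uncurry (eigenvalue (proj₁ q)) (remQuot m (proj₂ q)))
                                          (FinP.remQuot-combine ε (combine h a)))
                                    (cong (uncurry (eigenvalue ε)) (FinP.remQuot-combine h a))

  ∏-eigenvalue : ∀ x ε h → prodFin m (λ a → x - eigenvalue ε h a) ≡ factor x (sign (toℕ ε)) (sign (toℕ h))
  ∏-eigenvalue x ε h = begin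
    (x - (t + s * + m)) * prodFin (2 ℕ.* k) (λ _ → x - t) ≡⟨ cong ((x - (t + s * + m)) *_) (prodFin-const (2 ℕ.* k) (x - t)) ⟩
    (x - (t + s * + m)) * (x - t) ^ (2 ℕ.* k)             ≡⟨ ring x t s (+ m) ((x - t) ^ (2 ℕ.* k)) ⟩
    (x - t) ^ (2 ℕ.* k) * ((x - t) + - s * + m)           ∎
    where
    open ≡-Reasoning
    s = sign (toℕ ε)
    t = sign (toℕ h)
    ring : ∀ x t s m p → (x - (t + s * m)) * p ≡ p * ((x - t) + - s * m)
    ring = solve-∀

  ∏-eigenvalues : ∀ x → prodFin (2 ℕ.* n) (λ p → x - eigenvalues p) ≡ factors x
  ∏-eigenvalues x = trans (prodFin-combine n (λ p → x - eigenvalues p)) (cong₂ _*_ (level zero) (level (suc zero)))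
    where
    level : ∀ ε →
      prodFin n (λ i → x - eigenvalues (combine ε i)) ≡ factor x (sign (toℕ ε)) 1ℤ * factor x (sign (toℕ ε)) -1ℤ
    level ε = begin
      prodFin n (λ i → x - eigenvalues (combine ε i))
        ≡⟨ prodFin-combine m (λ i → x - eigenvalues (combine ε i)) ⟩
      prodFin m (λ a → x - eigenvalues (combine ε (combine {2} zero a)))
        * prodFin m (λ a → x - eigenvalues (combine ε (combine {2} (suc zero) a)))
        ≡⟨ cong₂ _*_ (prodFin-cong m λ a → cong (_-_ x) (eigenvalues-combine ε zero a))
                     (prodFin-cong m λ a → cong (_-_ x) (eigenvalues-combine ε (suc zero) a)) ⟩
      prodFin m (λ a → x - eigenvalue ε zero a) * prodFin m (λ a → x - eigenvalue ε (suc zero) a)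
        ≡⟨ cong₂ _*_ (∏-eigenvalue x ε zero) (∏-eigenvalue x ε (suc zero)) ⟩
      factor x (sign (toℕ ε)) 1ℤ * factor x (sign (toℕ ε)) -1ℤ
        ∎
      where open ≡-Reasoning

  count≡1⇒∈ : ∀ g (L : List.List (Fin (2 ℕ.* n))) → count D S g L ≡ 1ℤ → g ∈ L
  count≡1⇒∈ g (s List.∷ L) count≡1 with g ≟ s
  ... | yes g≡s = here g≡s
  ... | no _    = there (count≡1⇒∈ g L (trans (sym (ℤP.+-identityˡ (count D S g L))) count≡1))

  adjacent : ∀ x y → adj x y ≡ 1ℤ → Adjacent D S x y
  adjacent x y = count≡1⇒∈ (inv x · y) S
    where open FinGroupOps D

  reflection-step : ∀ (ε : Fin 2) (i j : Fin n) → parity (toℕ i) ≡ parity (toℕ j) →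
    Adjacent D S (combine ε i) (combine (Fin.opposite ε) j)
  reflection-step ε i j pᵢ≡pⱼ = adjacent (combine ε i) (combine (Fin.opposite ε) j) (trans (adj-cross ε i j) (cong evenIndicator
    (trans (cong (ℙ._+ parity (toℕ j)) pᵢ≡pⱼ) (ℙP.p+p≡0ℙ (parity (toℕ j))))))

  rotation-step : ∀ (ε : Fin 2) i → Adjacent D S (combine ε i) (combine ε (partner i))
  rotation-step ε i = adjacent (combine ε i) (combine ε (partner i))
    (trans (adj-same ε i (partner i)) (trans (cong (δ i) (partner-involutive i)) (δ-refl i)))

  parity-partner : ∀ i → parity (toℕ (partner i)) ≡ parity (toℕ i) ℙ.⁻¹
  parity-partner i = begin
    parity (toℕ (partner i))         ≡⟨ cong parity (toℕ-mod (m ℕ.+ toℕ i)) ⟩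
    parity ((m ℕ.+ toℕ i) % n)       ≡⟨ parity-% (m ℕ.+ toℕ i) n n-even ⟩
    parity (m ℕ.+ toℕ i)             ≡⟨ ℙP.+-homo-+ m (toℕ i) ⟩
    parity m ℙ.+ parity (toℕ i)      ≡⟨ cong (ℙ._+ parity (toℕ i)) m-odd ⟩
    parity (toℕ i) ℙ.⁻¹              ∎
    where open ≡-Reasoning

  walk-same-parity : ∀ (ε ε' : Fin 2) (i j : Fin n) → parity (toℕ i) ≡ parity (toℕ j) → Walk D S (combine ε i) (combine ε' j)
  walk-same-parity zero       (suc zero) i j pᵢ≡pⱼ = step (reflection-step zero i j pᵢ≡pⱼ) here
  walk-same-parity (suc zero) zero       i j pᵢ≡pⱼ = step (reflection-step (suc zero) i j pᵢ≡pⱼ) here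
  walk-same-parity zero       zero       i j pᵢ≡pⱼ =
    step {y = combine {2} (suc zero) j} (reflection-step zero i j pᵢ≡pⱼ) (step (reflection-step (suc zero) j j refl) here)
  walk-same-parity (suc zero) (suc zero) i j pᵢ≡pⱼ =
    step {y = combine {2} zero j} (reflection-step (suc zero) i j pᵢ≡pⱼ) (step (reflection-step zero j j refl) here)

  walk : ∀ (ε ε' : Fin 2) (i j : Fin n) → Walk D S (combine ε i) (combine ε' j)
  walk ε ε' i j with parity (toℕ i) ℙP.≟ parity (toℕ j)
  ... | yes pᵢ≡pⱼ = walk-same-parity ε ε' i j pᵢ≡pⱼ
  ... | no pᵢ≢pⱼ  = step (rotation-step ε i)
                         (walk-same-parity ε ε' (partner i) j (trans (parity-partner i) (other-parity _ _ pᵢ≢pⱼ)))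
    where
    other-parity : ∀ p q → p ≢ q → p ℙ.⁻¹ ≡ q
    other-parity 0ℙ 0ℙ 0≢0 = ⊥-elim (0≢0 refl)
    other-parity 0ℙ 1ℙ _   = refl
    other-parity 1ℙ 0ℙ _   = refl
    other-parity 1ℙ 1ℙ 1≢1 = ⊥-elim (1≢1 refl)

  connected : Connected D S
  connected p q = subst₂ (Walk D S) (FinP.combine-remQuot {2} n p) (FinP.combine-remQuot {2} n q)
                         (walk (proj₁ p′) (proj₁ q′) (proj₂ p′) (proj₂ q′))
    where
    p′ = remQuot {2} n p
    q′ = remQuot {2} n q

  integral : Integral (2 ℕ.* n) adj
  integral = eigenvalues , λ x → trans (charPoly x) (sym (∏-eigenvalues x))

open import Data.Nat using (_*_)

corollary2p1 : (k : ℕ) →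
    let m = suc (2 * k) in
    Connected (Dihedral.D m) (Dihedral.S m)
      × Integral (2 * (2 * m)) (adjMatrix (Dihedral.D m) (Dihedral.S m))
corollary2p1 k = OddDihedral.connected k , OddDihedral.integral k
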